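{- Let $A(l_1,l_2)\in\mathbb{C}[l_1,l_2]$ be of degree at most $R$ in each of $l_1$ and $l_2$, and assume that $T_{l_1,l_2}A(l_1,l_2)$ has total degree at most $R$ (i.e. is a linear combination of monomials $l_1^m l_2^n$ with $m+n\le R$). Then the polynomial $$ \sum_{l_1=k_1}^{k_2}\sum_{l_2=k_2}^{k_3}A(l_1,l_2)-A(k_2,k_2) $$ in $k_1,k_2,k_3$ has degree at most $R+2$ in $k_2$. Moreover, if $T_{l_1,l_2}A(l_1,l_2)=0$, then it has degree at most $R+1$ in $k_2$.
   Context: Sums use the extended convention: $\sum_{i=a}^b f(i)=f(a)+\cdots+f(b)$ if $a\le b$, $=0$ if $b=a-1$, and $=-f(b+1)-\cdots-f(a-1)$ if $b+1\le a-1$; with this convention, sums of polynomials over intervals with polynomial endpoints are polynomials in the endpoints. $E_x$ is the shift operator $E_xF(x)=F(x+1)$, $\Delta_x=E_x-\operatorname{id}$, and $S_{x,y}$ is the swapping operator $S_{x,y}F(x,y)=F(y,x)$. Define $V_{x,y}=\operatorname{id}+E_x^{ -1}\Delta_x\Delta_y$ and $$ T_{x,y}=(\operatorname{id}+E_yE_x^{ -1}S_{x,y})\,V_{x,y}\,(V_{x,y}+V_{y,x})^{ -1}, $$ where $V_{x,y}+V_{y,x}=2\operatorname{id}+(E_x^{ -1}+E_y^{ -1})\Delta_x\Delta_y$ is invertible on polynomials (its inverse is given by a geometric series that is finite on each polynomial). -}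

module Defs where

open import Level using (_⊔_)
open import Algebra.Bundles using (CommutativeRing)
open import Data.Nat as ℕ using (ℕ; zero; suc)
open import Data.Integer as ℤ using (ℤ; +_; -[1+_])
open import Data.Product using (Σ; ∃; _×_; _,_)

-- Everything is relative to a commutative ring R (stand-in for ℂ).
module Poly {c ℓ} (R : CommutativeRing c ℓ) where
  open CommutativeRing R

  ιℕ : ℕ → Carrier
  ιℕ zero    = 0#
  ιℕ (suc n) = 1# + ιℕ n

  ι : ℤ → Carrier
  ι (+ n)      = ιℕ n
  ι -[1+ n ]   = - ιℕ (suc n)

  QAlgebra : Set (c ⊔ ℓ)
  QAlgebra = Σ (ℕ → Carrier) λ inv → ∀ n → inv n * ιℕ (suc n) ≈ 1#

  pow : Carrier → ℕ → Carrier
  pow x zero    = 1#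
  pow x (suc n) = x * pow x n

  sumℕ : ℕ → (ℕ → Carrier) → Carrier
  sumℕ zero    f = 0#
  sumℕ (suc n) f = f 0 + sumℕ n (λ i → f (suc i))

  -- extended-convention sum  Σ_{i=a}^{b} f i  over integers
  sumℤ-aux : ℤ → ℤ → (ℤ → Carrier) → ℤ → Carrier
  sumℤ-aux a b f (+ m)     = sumℕ m (λ j → f (a ℤ.+ + j))
  sumℤ-aux a b f -[1+ m ]  = - sumℕ (suc m) (λ j → f (b ℤ.+ ℤ.1ℤ ℤ.+ + j))

  sumℤ : ℤ → ℤ → (ℤ → Carrier) → Carrier
  sumℤ a b f = sumℤ-aux a b f (b ℤ.- a ℤ.+ ℤ.1ℤ)

  -- functions of two integer variables (x = l₁, y = l₂)
  Fn2 : Set c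
  Fn2 = ℤ → ℤ → Carrier

  Fn3 : Set c
  Fn3 = ℤ → ℤ → ℤ → Carrier

  _⊕_ : Fn2 → Fn2 → Fn2
  (F ⊕ G) x y = F x y + G x y

  _⊖_ : Fn2 → Fn2 → Fn2
  (F ⊖ G) x y = F x y - G x y

  _·_ : Carrier → Fn2 → Fn2
  (k · F) x y = k * F x y

  Ex Exinv Ey Eyinv Δx Δy Sxy : Fn2 → Fn2
  Ex F x y    = F (x ℤ.+ ℤ.1ℤ) y
  Exinv F x y = F (x ℤ.- ℤ.1ℤ) y
  Ey F x y    = F x (y ℤ.+ ℤ.1ℤ)
  Eyinv F x y = F x (y ℤ.- ℤ.1ℤ)
  Δx F = Ex F ⊖ F
  Δy F = Ey F ⊖ F
  Sxy F x y = F y x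

  Vxy Vyx : Fn2 → Fn2
  Vxy F = F ⊕ Exinv (Δx (Δy F))
  Vyx F = F ⊕ Eyinv (Δy (Δx F))

  -- D = (E_x^{-1} + E_y^{-1}) Δ_x Δ_y, so that V_{x,y} + V_{y,x} = 2 id + D
  D : Fn2 → Fn2
  D F = Exinv (Δx (Δy F)) ⊕ Eyinv (Δx (Δy F))

  iter : ℕ → (Fn2 → Fn2) → Fn2 → Fn2
  iter zero    f F = F
  iter (suc n) f F = f (iter n f F)

  -- (2 id + D)^{-1} F = Σ_{k ≥ 0} (1/2)^{k+1} (-1)^k D^k F ; the series is
  -- truncated after N terms (N = r+1 suffices and is exact on polynomials of
  -- degree ≤ r in each variable, since D^{r+1} kills them).
  Winv : QAlgebra → ℕ → Fn2 → Fn2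
  Winv (inv , _) N F x y =
    sumℕ N (λ k → pow (- inv 1) k * inv 1 * iter k D F x y)

  -- T_{x,y} = (id + E_y E_x^{-1} S_{x,y}) V_{x,y} (V_{x,y} + V_{y,x})^{-1}
  T : QAlgebra → ℕ → Fn2 → Fn2
  T q N F = H ⊕ Ey (Exinv (Sxy H))
    where H = Vxy (Winv q N F)

  polyA : (r : ℕ) → (ℕ → ℕ → Carrier) → Fn2
  polyA r a x y = sumℕ (suc r) λ i → sumℕ (suc r) λ j → a i j * pow (ι x) i * pow (ι y) j

  TotDeg≤ : ℕ → Fn2 → Set (c ⊔ ℓ)
  TotDeg≤ r F = ∃ λ (b : ℕ → ℕ → Carrier) → ∀ x y →
    F x y ≈ sumℕ (suc r) (λ m → sumℕ (suc (r ℕ.∸ m)) λ n → b m n * pow (ι x) m * pow (ι y) n)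

  DegK₂≤ : ℕ → Fn3 → Set (c ⊔ ℓ)
  DegK₂≤ d G = ∃ λ (N : ℕ) → ∃ λ (b : ℕ → ℕ → ℕ → Carrier) → ∀ k₁ k₂ k₃ →
    G k₁ k₂ k₃ ≈ sumℕ N (λ i → sumℕ (suc d) λ j → sumℕ N λ k →
                   b i j k * pow (ι k₁) i * pow (ι k₂) j * pow (ι k₃) k)

  doubleSum : Fn2 → Fn3
  doubleSum A k₁ k₂ k₃ = sumℤ k₁ k₂ (λ l₁ → sumℤ k₂ k₃ (λ l₂ → A l₁ l₂)) - A k₂ k₂

{-# OPTIONS --safe #-}
-- Let W = (V_{x,y} + V_{y,x})⁻¹ A, computed by the truncated geometric series Winv,
-- which is exact because D lowers the degree in each variable. Then A = T A + S with
-- S(x,y) = α(x,y) − α(x,y−1) + α(x−1,y−1) for the antisymmetric α(x,y) = W(x+1,y) − W(y+1,x).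
-- In the double sum of S the sums over l₂ telescope and α cancels on the square
-- [k₁−1, k₂−1]², leaving terms of degree ≤ r+1 in k₂. The double sum of l₁^i l₂^j
-- factors as (Σ l₁^i)(Σ l₂^j) − k₂^(i+j) and has degree ≤ i+j+2 in k₂, which accounts
-- for T A. Degrees are measured by finite differences (Deg< n f means Δⁿ f = 0) and
-- turned back into polynomials by Newton interpolation; this is where the ℚ-algebra
-- hypothesis enters.
module Submission where

open import Defs
open import Algebra.Bundles using (CommutativeRing)
open import Data.Nat as ℕ using (ℕ; zero; suc; z≤n; s≤s)
import Data.Nat.Properties as ℕP
open import Data.Integer as ℤ using (ℤ; +_; -[1+_]; 0ℤ; 1ℤ)
import Data.Integer.Properties as ℤP
open import Data.Integer.Tactic.RingSolver using (solve-∀)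
open import Data.Product using (_×_; _,_; proj₁; proj₂)
open import Data.Maybe using (Maybe; just; nothing)
open import Relation.Binary.PropositionalEquality as ≡ using (_≡_)
open import Relation.Nullary using (yes; no)

ℤ-induction : ∀ {p} (P : ℤ → Set p) → P 0ℤ →
              (∀ x → P x → P (x ℤ.+ 1ℤ)) → (∀ x → P x → P (x ℤ.- 1ℤ)) → ∀ x → P x
ℤ-induction P P0 up down (+ n) = pos n
  where
  pos : ∀ n → P (+ n)
  pos zero    = P0
  pos (suc n) = ≡.subst P (≡.cong +_ (ℕP.+-comm n 1)) (up (+ n) (pos n))
ℤ-induction P P0 up down -[1+ n ] = neg n
  where
  neg : ∀ n → P -[1+ n ]
  neg zero    = down 0ℤ P0
  neg (suc n) = ≡.subst P (≡.cong (λ k → -[1+ suc k ]) (ℕP.+-identityʳ n)) (down _ (neg n))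

module IntegerCoefficients {c ℓ} (R : CommutativeRing c ℓ) where
  open CommutativeRing R
  open Poly R using (ιℕ; ι)
  open import Algebra.Properties.Ring ring
    using (-‿involutive; -0#≈0#; -‿+-comm; -‿distribʳ-*)
  open import Relation.Binary.Reasoning.Setoid setoid
  open import Algebra.Solver.Ring.AlmostCommutativeRing as ACR
    using (_-Raw-AlmostCommutative⟶_)

  ι-suc : ∀ x → ι (x ℤ.+ 1ℤ) ≈ ι x + 1#
  ι-suc (+ zero)         = +-comm 1# 0#
  ι-suc (+ suc n)        = trans (+-congˡ (ι-suc (+ n))) (sym (+-assoc 1# (ιℕ n) 1#))
  ι-suc -[1+ zero ]      = sym (trans (+-congʳ (-‿cong (+-identityʳ 1#))) (-‿inverseˡ 1#))
  ι-suc -[1+ suc n ]     = begin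
    - (1# + ιℕ n)                    ≈⟨ sym (+-identityʳ _) ⟩
    - (1# + ιℕ n) + 0#               ≈⟨ +-congˡ (sym (-‿inverseˡ 1#)) ⟩
    - (1# + ιℕ n) + (- 1# + 1#)      ≈⟨ sym (+-assoc _ _ _) ⟩
    (- (1# + ιℕ n) + - 1#) + 1#      ≈⟨ +-congʳ (trans (+-comm _ _) (-‿+-comm 1# (1# + ιℕ n))) ⟩
    - (1# + (1# + ιℕ n)) + 1#        ∎

  ι-pred : ∀ x → ι (x ℤ.- 1ℤ) ≈ ι x - 1#
  ι-pred x = begin
    ι (x ℤ.- 1ℤ)                    ≈⟨ sym (+-identityʳ _) ⟩
    ι (x ℤ.- 1ℤ) + 0#               ≈⟨ +-congˡ (sym (-‿inverseʳ 1#)) ⟩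
    ι (x ℤ.- 1ℤ) + (1# - 1#)        ≈⟨ sym (+-assoc _ _ _) ⟩
    (ι (x ℤ.- 1ℤ) + 1#) - 1#        ≈⟨ +-congʳ (sym (ι-suc (x ℤ.- 1ℤ))) ⟩
    ι (x ℤ.- 1ℤ ℤ.+ 1ℤ) - 1#        ≡⟨ ≡.cong (λ y → ι y - 1#) (pred-suc x) ⟩
    ι x - 1#                        ∎
    where
    pred-suc : ∀ x → x ℤ.- 1ℤ ℤ.+ 1ℤ ≡ x
    pred-suc = solve-∀

  ι-neg : ∀ x → ι (ℤ.- x) ≈ - ι x
  ι-neg (+ zero)   = sym -0#≈0#
  ι-neg (+ suc n)  = refl
  ι-neg -[1+ n ]   = sym (-‿involutive _)

  ι-+ : ∀ x y → ι (x ℤ.+ y) ≈ ι x + ι y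
  ι-+ x = ℤ-induction (λ y → ι (x ℤ.+ y) ≈ ι x + ι y) base up down
    where
    base : ι (x ℤ.+ 0ℤ) ≈ ι x + 0#
    base = trans (reflexive (≡.cong ι (ℤP.+-identityʳ x))) (sym (+-identityʳ _))
    up : ∀ y → ι (x ℤ.+ y) ≈ ι x + ι y → ι (x ℤ.+ (y ℤ.+ 1ℤ)) ≈ ι x + ι (y ℤ.+ 1ℤ)
    up y ih = begin
      ι (x ℤ.+ (y ℤ.+ 1ℤ))   ≡⟨ ≡.cong ι (≡.sym (ℤP.+-assoc x y 1ℤ)) ⟩
      ι (x ℤ.+ y ℤ.+ 1ℤ)     ≈⟨ ι-suc (x ℤ.+ y) ⟩
      ι (x ℤ.+ y) + 1#       ≈⟨ +-congʳ ih ⟩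
      (ι x + ι y) + 1#       ≈⟨ +-assoc _ _ _ ⟩
      ι x + (ι y + 1#)       ≈⟨ +-congˡ (sym (ι-suc y)) ⟩
      ι x + ι (y ℤ.+ 1ℤ)     ∎
    down : ∀ y → ι (x ℤ.+ y) ≈ ι x + ι y → ι (x ℤ.+ (y ℤ.- 1ℤ)) ≈ ι x + ι (y ℤ.- 1ℤ)
    down y ih = begin
      ι (x ℤ.+ (y ℤ.- 1ℤ))   ≡⟨ ≡.cong ι (≡.sym (ℤP.+-assoc x y (ℤ.- 1ℤ))) ⟩
      ι (x ℤ.+ y ℤ.- 1ℤ)     ≈⟨ ι-pred (x ℤ.+ y) ⟩
      ι (x ℤ.+ y) - 1#       ≈⟨ +-congʳ ih ⟩
      (ι x + ι y) - 1#       ≈⟨ +-assoc _ _ _ ⟩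
      ι x + (ι y - 1#)       ≈⟨ +-congˡ (sym (ι-pred y)) ⟩
      ι x + ι (y ℤ.- 1ℤ)     ∎

  ι-* : ∀ x y → ι (x ℤ.* y) ≈ ι x * ι y
  ι-* x = ℤ-induction (λ y → ι (x ℤ.* y) ≈ ι x * ι y) base up down
    where
    base : ι (x ℤ.* 0ℤ) ≈ ι x * 0#
    base = trans (reflexive (≡.cong ι (ℤP.*-zeroʳ x))) (sym (zeroʳ _))
    up : ∀ y → ι (x ℤ.* y) ≈ ι x * ι y → ι (x ℤ.* (y ℤ.+ 1ℤ)) ≈ ι x * ι (y ℤ.+ 1ℤ)
    up y ih = begin
      ι (x ℤ.* (y ℤ.+ 1ℤ))    ≡⟨ ≡.cong ι (*-suc x y) ⟩
      ι (x ℤ.* y ℤ.+ x)       ≈⟨ ι-+ (x ℤ.* y) x ⟩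
      ι (x ℤ.* y) + ι x       ≈⟨ +-cong ih (sym (*-identityʳ _)) ⟩
      ι x * ι y + ι x * 1#    ≈⟨ sym (distribˡ _ _ _) ⟩
      ι x * (ι y + 1#)        ≈⟨ *-congˡ (sym (ι-suc y)) ⟩
      ι x * ι (y ℤ.+ 1ℤ)      ∎
      where
      *-suc : ∀ x y → x ℤ.* (y ℤ.+ 1ℤ) ≡ x ℤ.* y ℤ.+ x
      *-suc = solve-∀
    down : ∀ y → ι (x ℤ.* y) ≈ ι x * ι y → ι (x ℤ.* (y ℤ.- 1ℤ)) ≈ ι x * ι (y ℤ.- 1ℤ)
    down y ih = begin
      ι (x ℤ.* (y ℤ.- 1ℤ))       ≡⟨ ≡.cong ι (*-pred x y) ⟩
      ι (x ℤ.* y ℤ.+ ℤ.- x)      ≈⟨ ι-+ (x ℤ.* y) (ℤ.- x) ⟩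
      ι (x ℤ.* y) + ι (ℤ.- x)    ≈⟨ +-cong ih (trans (ι-neg x) (-‿cong (sym (*-identityʳ _)))) ⟩
      ι x * ι y - ι x * 1#       ≈⟨ +-congˡ (-‿distribʳ-* (ι x) 1#) ⟩
      ι x * ι y + ι x * - 1#     ≈⟨ sym (distribˡ _ _ _) ⟩
      ι x * (ι y - 1#)           ≈⟨ *-congˡ (sym (ι-pred y)) ⟩
      ι x * ι (y ℤ.- 1ℤ)         ∎
      where
      *-pred : ∀ x y → x ℤ.* (y ℤ.- 1ℤ) ≡ x ℤ.* y ℤ.+ ℤ.- x
      *-pred = solve-∀

  -- The solver checks its normal forms by refl, so the coefficient 1 has to be
  -- interpreted as 1# itself rather than as ι 1 = 1# + 0#.
  ⟦_⟧ : ℤ → Carrier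
  ⟦ + 1 ⟧ = 1#
  ⟦ x   ⟧ = ι x

  ⟦⟧≈ι : ∀ x → ⟦ x ⟧ ≈ ι x
  ⟦⟧≈ι (+ zero)          = refl
  ⟦⟧≈ι (+ suc zero)      = sym (+-identityʳ 1#)
  ⟦⟧≈ι (+ suc (suc n))   = refl
  ⟦⟧≈ι -[1+ n ]          = refl

  ⟦⟧-homomorphism : ℤ.+-*-rawRing -Raw-AlmostCommutative⟶ ACR.fromCommutativeRing R
  ⟦⟧-homomorphism = record
    { ⟦_⟧    = ⟦_⟧
    ; +-homo = λ x y → trans (⟦⟧≈ι (x ℤ.+ y)) (trans (ι-+ x y) (sym (+-cong (⟦⟧≈ι x) (⟦⟧≈ι y))))
    ; *-homo = λ x y → trans (⟦⟧≈ι (x ℤ.* y)) (trans (ι-* x y) (sym (*-cong (⟦⟧≈ι x) (⟦⟧≈ι y))))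
    ; -‿homo = λ x → trans (⟦⟧≈ι (ℤ.- x)) (trans (ι-neg x) (sym (-‿cong (⟦⟧≈ι x))))
    ; 0-homo = refl
    ; 1-homo = refl
    }

  private
    ⟦⟧-equal? : ∀ x y → Maybe (⟦ x ⟧ ≈ ⟦ y ⟧)
    ⟦⟧-equal? x y with x ℤ.≟ y
    ... | yes ≡.refl = just refl
    ... | no _       = nothing

  open import Algebra.Solver.Ring ℤ.+-*-rawRing (ACR.fromCommutativeRing R) ⟦⟧-homomorphism ⟦⟧-equal? public
    using (solve; _:=_; con; _:+_; _:*_; _:-_; :-_)

module FiniteSums {c ℓ} (R : CommutativeRing c ℓ) where
  open CommutativeRing R
  open Poly R using (sumℕ)
  open IntegerCoefficients R

  sumℕ-cong : ∀ n {f g : ℕ → Carrier} → (∀ i → f i ≈ g i) → sumℕ n f ≈ sumℕ n g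
  sumℕ-cong zero    f≈g = refl
  sumℕ-cong (suc n) f≈g = +-cong (f≈g 0) (sumℕ-cong n (λ i → f≈g (suc i)))

  sumℕ-cong-< : ∀ n {f g : ℕ → Carrier} → (∀ i → i ℕ.< n → f i ≈ g i) → sumℕ n f ≈ sumℕ n g
  sumℕ-cong-< zero    f≈g = refl
  sumℕ-cong-< (suc n) f≈g = +-cong (f≈g 0 (s≤s z≤n)) (sumℕ-cong-< n (λ i i<n → f≈g (suc i) (s≤s i<n)))

  sumℕ-zero : ∀ n {f : ℕ → Carrier} → (∀ i → f i ≈ 0#) → sumℕ n f ≈ 0#
  sumℕ-zero zero    f≈0 = refl
  sumℕ-zero (suc n) f≈0 = trans (+-cong (f≈0 0) (sumℕ-zero n (λ i → f≈0 (suc i)))) (+-identityˡ 0#)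

  sumℕ-+ : ∀ n (f g : ℕ → Carrier) → sumℕ n (λ i → f i + g i) ≈ sumℕ n f + sumℕ n g
  sumℕ-+ zero    f g = sym (+-identityˡ 0#)
  sumℕ-+ (suc n) f g = trans (+-congˡ (sumℕ-+ n _ _))
    (solve 4 (λ a b c d → (a :+ b) :+ (c :+ d) := (a :+ c) :+ (b :+ d)) refl _ _ _ _)

  sumℕ-*ˡ : ∀ n k (f : ℕ → Carrier) → sumℕ n (λ i → k * f i) ≈ k * sumℕ n f
  sumℕ-*ˡ zero    k f = sym (zeroʳ k)
  sumℕ-*ˡ (suc n) k f = trans (+-congˡ (sumℕ-*ˡ n k _)) (sym (distribˡ k _ _))

  sumℕ-*ʳ : ∀ n k (f : ℕ → Carrier) → sumℕ n (λ i → f i * k) ≈ sumℕ n f * k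
  sumℕ-*ʳ n k f = trans (sumℕ-cong n (λ i → *-comm (f i) k)) (trans (sumℕ-*ˡ n k f) (*-comm k _))

  sumℕ²-*ʳ : ∀ m n k (f : ℕ → ℕ → Carrier) →
             sumℕ m (λ i → sumℕ n (f i)) * k ≈ sumℕ m (λ i → sumℕ n (λ j → f i j * k))
  sumℕ²-*ʳ m n k f = trans (sym (sumℕ-*ʳ m k _)) (sumℕ-cong m (λ i → sym (sumℕ-*ʳ n k (f i))))

  sumℕ-- : ∀ n (f g : ℕ → Carrier) → sumℕ n (λ i → f i - g i) ≈ sumℕ n f - sumℕ n g
  sumℕ-- zero    f g = sym (-‿inverseʳ 0#)
  sumℕ-- (suc n) f g = trans (+-congˡ (sumℕ-- n _ _))
    (solve 4 (λ a b c d → (a :- b) :+ (c :- d) := (a :+ c) :- (b :+ d)) refl _ _ _ _)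

  sumℕ-swap : ∀ m n (f : ℕ → ℕ → Carrier) →
              sumℕ m (λ i → sumℕ n (f i)) ≈ sumℕ n (λ j → sumℕ m (λ i → f i j))
  sumℕ-swap zero    n f = sym (sumℕ-zero n (λ _ → refl))
  sumℕ-swap (suc m) n f = trans (+-congˡ (sumℕ-swap m n (λ i → f (suc i)))) (sym (sumℕ-+ n _ _))

  sumℕ-telescope : ∀ n (f : ℕ → Carrier) → sumℕ n (λ i → f i - f (suc i)) ≈ f 0 - f n
  sumℕ-telescope zero    f = sym (-‿inverseʳ (f 0))
  sumℕ-telescope (suc n) f = trans (+-congˡ (sumℕ-telescope n (λ i → f (suc i))))
    (solve 3 (λ a b c → (a :- b) :+ (b :- c) := a :- c) refl _ _ _)

  sumℕ-snoc : ∀ n (f : ℕ → Carrier) → sumℕ (suc n) f ≈ sumℕ n f + f n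
  sumℕ-snoc zero    f = +-comm _ _
  sumℕ-snoc (suc n) f = trans (+-congˡ (sumℕ-snoc n (λ i → f (suc i)))) (sym (+-assoc _ _ _))

module Differences {c ℓ} (R : CommutativeRing c ℓ) where
  open CommutativeRing R
  open IntegerCoefficients R
  open import Relation.Binary.Reasoning.Setoid setoid

  Fn1 : Set c
  Fn1 = ℤ → Carrier

  Δ : Fn1 → Fn1
  Δ f x = f (x ℤ.+ 1ℤ) - f x

  Δ-cong : ∀ {f g : Fn1} → (∀ x → f x ≈ g x) → ∀ x → Δ f x ≈ Δ g x
  Δ-cong f≈g x = +-cong (f≈g _) (-‿cong (f≈g x))

  Δ-+ : ∀ (u v : Fn1) x → Δ (λ y → u y + v y) x ≈ Δ u x + Δ v x
  Δ-+ u v x = solve 4 (λ a b c d → (a :+ b) :- (c :+ d) := (a :- c) :+ (b :- d)) refl _ _ _ _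

  Δ-neg : ∀ (u : Fn1) x → Δ (λ y → - u y) x ≈ - Δ u x
  Δ-neg u x = solve 2 (λ a b → :- a :- :- b := :- (a :- b)) refl _ _

  Δ-- : ∀ (u v : Fn1) x → Δ (λ y → u y - v y) x ≈ Δ u x - Δ v x
  Δ-- u v x = trans (Δ-+ u (λ y → - v y) x) (+-congˡ (Δ-neg v x))

  Δ-*ˡ : ∀ k (u : Fn1) x → Δ (λ y → k * u y) x ≈ k * Δ u x
  Δ-*ˡ k u x = solve 3 (λ k a b → k :* a :- k :* b := k :* (a :- b)) refl _ _ _

  Δ-unique : ∀ {u v : Fn1} x₀ → (∀ x → Δ u x ≈ Δ v x) → u x₀ ≈ v x₀ → ∀ x → u x ≈ v x
  Δ-unique {u} {v} x₀ Δu≈Δv u≈v x =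
    ≡.subst (λ y → u y ≈ v y) (x₀+[x-x₀]≡x x₀ x)
      (ℤ-induction (λ d → u (x₀ ℤ.+ d) ≈ v (x₀ ℤ.+ d)) base up down (x ℤ.- x₀))
    where
    x₀+[x-x₀]≡x : ∀ x₀ x → x₀ ℤ.+ (x ℤ.- x₀) ≡ x
    x₀+[x-x₀]≡x = solve-∀
    +-suc : ∀ x₀ d → x₀ ℤ.+ (d ℤ.+ 1ℤ) ≡ x₀ ℤ.+ d ℤ.+ 1ℤ
    +-suc = solve-∀
    +-pred : ∀ x₀ d → x₀ ℤ.+ (d ℤ.- 1ℤ) ℤ.+ 1ℤ ≡ x₀ ℤ.+ d
    +-pred = solve-∀
    forward : ∀ (w : Fn1) y → w (y ℤ.+ 1ℤ) ≈ w y + Δ w y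
    forward w y = solve 2 (λ a b → b := a :+ (b :- a)) refl (w y) (w (y ℤ.+ 1ℤ))
    backward : ∀ (w : Fn1) y → w y ≈ w (y ℤ.+ 1ℤ) - Δ w y
    backward w y = solve 2 (λ a b → a := b :- (b :- a)) refl (w y) (w (y ℤ.+ 1ℤ))
    base : u (x₀ ℤ.+ 0ℤ) ≈ v (x₀ ℤ.+ 0ℤ)
    base = ≡.subst (λ y → u y ≈ v y) (≡.sym (ℤP.+-identityʳ x₀)) u≈v
    up : ∀ d → u (x₀ ℤ.+ d) ≈ v (x₀ ℤ.+ d) → u (x₀ ℤ.+ (d ℤ.+ 1ℤ)) ≈ v (x₀ ℤ.+ (d ℤ.+ 1ℤ))
    up d ih = ≡.subst (λ y → u y ≈ v y) (≡.sym (+-suc x₀ d)) (begin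
      u (y ℤ.+ 1ℤ)   ≈⟨ forward u y ⟩
      u y + Δ u y    ≈⟨ +-cong ih (Δu≈Δv y) ⟩
      v y + Δ v y    ≈⟨ forward v y ⟨
      v (y ℤ.+ 1ℤ)   ∎)
      where y = x₀ ℤ.+ d
    down : ∀ d → u (x₀ ℤ.+ d) ≈ v (x₀ ℤ.+ d) → u (x₀ ℤ.+ (d ℤ.- 1ℤ)) ≈ v (x₀ ℤ.+ (d ℤ.- 1ℤ))
    down d ih = begin
      u y                    ≈⟨ backward u y ⟩
      u (y ℤ.+ 1ℤ) - Δ u y   ≈⟨ +-cong (≡.subst (λ z → u z ≈ v z) (≡.sym (+-pred x₀ d)) ih) (-‿cong (Δu≈Δv y)) ⟩
      v (y ℤ.+ 1ℤ) - Δ v y   ≈⟨ backward v y ⟨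
      v y                    ∎
      where y = x₀ ℤ.+ (d ℤ.- 1ℤ)

module IntervalSums {c ℓ} (R : CommutativeRing c ℓ) where
  open CommutativeRing R
  open Poly R using (sumℕ; sumℤ; sumℤ-aux)
  open IntegerCoefficients R
  open FiniteSums R
  open Differences R
  open import Relation.Binary.Reasoning.Setoid setoid

  private
    sumℤ-by-length : ∀ a b f {k} → b ℤ.- a ℤ.+ 1ℤ ≡ k → sumℤ a b f ≡ sumℤ-aux a b f k
    sumℤ-by-length a b f = ≡.cong (sumℤ-aux a b f)

    f-cong : ∀ (f : Fn1) {x y} → x ≡ y → f x ≈ f y
    f-cong f ≡.refl = refl

  sumℤ-empty : ∀ a f → sumℤ a (a ℤ.- 1ℤ) f ≈ 0#
  sumℤ-empty a f = reflexive (sumℤ-by-length a (a ℤ.- 1ℤ) f (length-0 a))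
    where
    length-0 : ∀ a → a ℤ.- 1ℤ ℤ.- a ℤ.+ 1ℤ ≡ 0ℤ
    length-0 = solve-∀

  sumℤ-singleton : ∀ a f → sumℤ a a f ≈ f a
  sumℤ-singleton a f = begin
    sumℤ a a f            ≡⟨ sumℤ-by-length a a f (length-1 a) ⟩
    f (a ℤ.+ + 0) + 0#    ≈⟨ +-identityʳ _ ⟩
    f (a ℤ.+ + 0)         ≈⟨ f-cong f (ℤP.+-identityʳ a) ⟩
    f a                   ∎
    where
    length-1 : ∀ a → a ℤ.- a ℤ.+ 1ℤ ≡ 1ℤ
    length-1 = solve-∀

  sumℤ-stepʳ : ∀ a b f → sumℤ a (b ℤ.+ 1ℤ) f ≈ sumℤ a b f + f (b ℤ.+ 1ℤ)
  sumℤ-stepʳ a b f = by-length (b ℤ.- a ℤ.+ 1ℤ) ≡.refl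
    where
    length-suc : ∀ a b → b ℤ.+ 1ℤ ℤ.- a ℤ.+ 1ℤ ≡ (b ℤ.- a ℤ.+ 1ℤ) ℤ.+ 1ℤ
    length-suc = solve-∀
    start+length : ∀ a b → a ℤ.+ (b ℤ.- a ℤ.+ 1ℤ) ≡ b ℤ.+ 1ℤ
    start+length = solve-∀
    shift-suc : ∀ b j → b ℤ.+ 1ℤ ℤ.+ 1ℤ ℤ.+ j ≡ b ℤ.+ 1ℤ ℤ.+ (j ℤ.+ 1ℤ)
    shift-suc = solve-∀
    b+1 = b ℤ.+ 1ℤ
    by-length : ∀ k → b ℤ.- a ℤ.+ 1ℤ ≡ k → sumℤ a b+1 f ≈ sumℤ a b f + f b+1
    by-length (+ m) eq = begin
      sumℤ a b+1 f                  ≡⟨ sumℤ-by-length a b+1 f (≡.trans (length-suc a b)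
                                        (≡.trans (≡.cong (ℤ._+ 1ℤ) eq) (≡.cong +_ (ℕP.+-comm m 1)))) ⟩
      sumℕ (suc m) g               ≈⟨ sumℕ-snoc m g ⟩
      sumℕ m g + g m               ≈⟨ +-cong (reflexive (≡.sym (sumℤ-by-length a b f eq)))
                                             (f-cong f (≡.trans (≡.cong (λ k → a ℤ.+ k) (≡.sym eq)) (start+length a b))) ⟩
      sumℤ a b f + f b+1            ∎
      where g = λ j → f (a ℤ.+ + j)
    by-length -[1+ zero ] eq = begin
      sumℤ a b+1 f                  ≡⟨ sumℤ-by-length a b+1 f (≡.trans (length-suc a b) (≡.cong (ℤ._+ 1ℤ) eq)) ⟩
      0#                           ≈⟨ solve 1 (λ y → con (+ 0) := :- (y :+ con (+ 0)) :+ y) refl _ ⟩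
      - (f b+1 + 0#) + f b+1         ≈⟨ +-congʳ (-‿cong (+-congʳ (f-cong f (ℤP.+-identityʳ b+1)))) ⟨
      - sumℕ 1 (λ j → f (b+1 ℤ.+ + j)) + f b+1
                                   ≡⟨ ≡.cong (_+ f b+1) (sumℤ-by-length a b f eq) ⟨
      sumℤ a b f + f b+1            ∎
    by-length -[1+ suc m ] eq = begin
      sumℤ a b+1 f                  ≡⟨ sumℤ-by-length a b+1 f (≡.trans (length-suc a b) (≡.cong (ℤ._+ 1ℤ) eq)) ⟩
      - sumℕ (suc m) (λ j → f (b+1 ℤ.+ 1ℤ ℤ.+ + j))
                                   ≈⟨ -‿cong (sumℕ-cong (suc m) (λ j → f-cong f
                                        (≡.trans (shift-suc b (+ j)) (≡.cong (λ k → b+1 ℤ.+ k) (≡.cong +_ (ℕP.+-comm j 1)))))) ⟩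
      - X                          ≈⟨ solve 2 (λ x y → :- x := :- (y :+ x) :+ y) refl _ _ ⟩
      - (f b+1 + X) + f b+1          ≈⟨ +-congʳ (-‿cong (+-congʳ (f-cong f (ℤP.+-identityʳ b+1)))) ⟨
      - sumℕ (suc (suc m)) (λ j → f (b+1 ℤ.+ + j)) + f b+1
                                   ≡⟨ ≡.cong (_+ f b+1) (sumℤ-by-length a b f eq) ⟨
      sumℤ a b f + f b+1            ∎
      where X = sumℕ (suc m) (λ j → f (b+1 ℤ.+ + suc j))

  Δ-sumℤ : ∀ a f b → Δ (λ b → sumℤ a b f) b ≈ f (b ℤ.+ 1ℤ)
  Δ-sumℤ a f b = trans (+-congʳ (sumℤ-stepʳ a b f)) (solve 2 (λ s y → s :+ y :- s := y) refl _ _)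

  sumℤ-unique : ∀ a f (u : Fn1) → u (a ℤ.- 1ℤ) ≈ 0# → (∀ b → Δ u b ≈ f (b ℤ.+ 1ℤ)) →
                ∀ b → u b ≈ sumℤ a b f
  sumℤ-unique a f u u₀ Δu = Δ-unique (a ℤ.- 1ℤ) (λ b → trans (Δu b) (sym (Δ-sumℤ a f b)))
                                     (trans u₀ (sym (sumℤ-empty a f)))

  sumℤ-cong : ∀ a b {f g : Fn1} → (∀ l → f l ≈ g l) → sumℤ a b f ≈ sumℤ a b g
  sumℤ-cong a b {f} {g} f≈g =
    sumℤ-unique a g (λ b → sumℤ a b f) (sumℤ-empty a f) (λ x → trans (Δ-sumℤ a f x) (f≈g _)) b

  sumℤ-zero : ∀ a b {f : Fn1} → (∀ l → f l ≈ 0#) → sumℤ a b f ≈ 0#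
  sumℤ-zero a b {f} f≈0 =
    sym (sumℤ-unique a f (λ _ → 0#) refl (λ x → trans (-‿inverseʳ 0#) (sym (f≈0 _))) b)

  sumℤ-+ : ∀ a b (f g : Fn1) → sumℤ a b (λ l → f l + g l) ≈ sumℤ a b f + sumℤ a b g
  sumℤ-+ a b f g = sym (sumℤ-unique a _ (λ b → S f b + S g b)
    (trans (+-cong (sumℤ-empty a f) (sumℤ-empty a g)) (+-identityˡ 0#))
    (λ x → trans (Δ-+ (S f) (S g) x) (+-cong (Δ-sumℤ a f x) (Δ-sumℤ a g x))) b)
    where S = λ h b → sumℤ a b h

  sumℤ-*ˡ : ∀ a b k (f : Fn1) → sumℤ a b (λ l → k * f l) ≈ k * sumℤ a b f
  sumℤ-*ˡ a b k f = sym (sumℤ-unique a _ (λ b → k * sumℤ a b f)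
    (trans (*-congˡ (sumℤ-empty a f)) (zeroʳ k))
    (λ x → trans (Δ-*ˡ k (λ b → sumℤ a b f) x) (*-congˡ (Δ-sumℤ a f x))) b)

  sumℤ-*ʳ : ∀ a b k (f : Fn1) → sumℤ a b (λ l → f l * k) ≈ sumℤ a b f * k
  sumℤ-*ʳ a b k f = trans (sumℤ-cong a b (λ l → *-comm (f l) k)) (trans (sumℤ-*ˡ a b k f) (*-comm k _))

  sumℤ-- : ∀ a b (f g : Fn1) → sumℤ a b (λ l → f l - g l) ≈ sumℤ a b f - sumℤ a b g
  sumℤ-- a b f g = sym (sumℤ-unique a _ (λ b → S f b - S g b)
    (trans (+-cong (sumℤ-empty a f) (-‿cong (sumℤ-empty a g))) (-‿inverseʳ 0#))
    (λ x → trans (Δ-- (S f) (S g) x) (+-cong (Δ-sumℤ a f x) (-‿cong (Δ-sumℤ a g x)))) b)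
    where S = λ h b → sumℤ a b h

  sumℤ-split : ∀ a b e f → sumℤ b e f ≈ sumℤ a e f - sumℤ a (b ℤ.- 1ℤ) f
  sumℤ-split a b e f = sym (sumℤ-unique b f (λ e → sumℤ a e f - sumℤ a (b ℤ.- 1ℤ) f) (-‿inverseʳ _)
    (λ x → trans (solve 3 (λ u v w → (u :- w) :- (v :- w) := u :- v) refl _ _ _) (Δ-sumℤ a f x)) e)

  sumℤ-init : ∀ a b f → sumℤ a (b ℤ.- 1ℤ) f ≈ sumℤ a b f - f b
  sumℤ-init a b f = trans (solve 2 (λ S S' → S' := S :- (S :- S')) refl (sumℤ a b f) _)
    (+-congˡ (-‿cong (sym (trans (sym (sumℤ-singleton b f)) (sumℤ-split a b b f)))))

  sumℤ-shift : ∀ a b s f → sumℤ a b (λ l → f (l ℤ.+ s)) ≈ sumℤ (a ℤ.+ s) (b ℤ.+ s) f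
  sumℤ-shift a b s f = sym (sumℤ-unique a _ (λ b → sumℤ (a ℤ.+ s) (b ℤ.+ s) f)
    (trans (reflexive (≡.cong (λ e → sumℤ (a ℤ.+ s) e f) (pred-+ a s))) (sumℤ-empty (a ℤ.+ s) f))
    (λ x → trans (+-congʳ (reflexive (≡.cong (λ e → sumℤ (a ℤ.+ s) e f) (suc-+ x s))))
                 (trans (Δ-sumℤ (a ℤ.+ s) f (x ℤ.+ s)) (f-cong f (≡.sym (suc-+ x s))))) b)
    where
    pred-+ : ∀ a s → a ℤ.- 1ℤ ℤ.+ s ≡ a ℤ.+ s ℤ.- 1ℤ
    pred-+ = solve-∀
    suc-+ : ∀ x s → x ℤ.+ 1ℤ ℤ.+ s ≡ x ℤ.+ s ℤ.+ 1ℤ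
    suc-+ = solve-∀

  sumℤ-telescope : ∀ a b (g : Fn1) → sumℤ a b (λ l → g l - g (l ℤ.- 1ℤ)) ≈ g b - g (a ℤ.- 1ℤ)
  sumℤ-telescope a b g = sym (sumℤ-unique a _ (λ b → g b - g (a ℤ.- 1ℤ)) (-‿inverseʳ _)
    (λ x → trans (solve 3 (λ u v w → (u :- w) :- (v :- w) := u :- v) refl _ _ _)
                 (+-congˡ (-‿cong (f-cong g (≡.sym (suc-pred x)))))) b)
    where
    suc-pred : ∀ x → x ℤ.+ 1ℤ ℤ.- 1ℤ ≡ x
    suc-pred = solve-∀

  sumℤ-swap : ∀ a b c d (F : ℤ → ℤ → Carrier) →
              sumℤ a b (λ x → sumℤ c d (F x)) ≈ sumℤ c d (λ y → sumℤ a b (λ x → F x y))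
  sumℤ-swap a b c d F = sym (sumℤ-unique a _ (λ b → sumℤ c d (λ y → sumℤ a b (λ x → F x y)))
    (sumℤ-zero c d (λ y → sumℤ-empty a _))
    (λ x → trans (sym (sumℤ-- c d _ _)) (sumℤ-cong c d (λ y → Δ-sumℤ a (λ x → F x y) x))) b)

module Degree {c ℓ} (R : CommutativeRing c ℓ) where
  open CommutativeRing R
  open import Algebra.Properties.Ring ring using (-0#≈0#)
  open Poly R using (ι; pow; sumℕ; sumℤ)
  open IntegerCoefficients R
  open Differences R
  open IntervalSums R

  Deg< : ℕ → Fn1 → Set ℓ
  Deg< zero    f = ∀ x → f x ≈ 0#
  Deg< (suc n) f = Deg< n (Δ f)

  Deg<-cong : ∀ n {f g : Fn1} → (∀ x → f x ≈ g x) → Deg< n f → Deg< n g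
  Deg<-cong zero    f≈g f≈0 x = trans (sym (f≈g x)) (f≈0 x)
  Deg<-cong (suc n) f≈g d     = Deg<-cong n (Δ-cong f≈g) d

  Deg<-zero : ∀ n {f : Fn1} → (∀ x → f x ≈ 0#) → Deg< n f
  Deg<-zero zero    f≈0 = f≈0
  Deg<-zero (suc n) f≈0 = Deg<-zero n (λ x → trans (Δ-cong f≈0 x) (-‿inverseʳ 0#))

  Deg<-mono : ∀ {m n} {f : Fn1} → m ℕ.≤ n → Deg< m f → Deg< n f
  Deg<-mono {n = n} z≤n     f≈0 = Deg<-zero n f≈0
  Deg<-mono         (s≤s m≤n) d = Deg<-mono m≤n d

  Deg<-+ : ∀ n {f g : Fn1} → Deg< n f → Deg< n g → Deg< n (λ x → f x + g x)
  Deg<-+ zero    df dg x = trans (+-cong (df x) (dg x)) (+-identityˡ 0#)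
  Deg<-+ (suc n) {f} {g} df dg = Deg<-cong n (λ x → sym (Δ-+ f g x)) (Deg<-+ n df dg)

  Deg<-neg : ∀ n {f : Fn1} → Deg< n f → Deg< n (λ x → - f x)
  Deg<-neg zero    df x = trans (-‿cong (df x)) -0#≈0#
  Deg<-neg (suc n) {f} df = Deg<-cong n (λ x → sym (Δ-neg f x)) (Deg<-neg n df)

  Deg<-- : ∀ n {f g : Fn1} → Deg< n f → Deg< n g → Deg< n (λ x → f x - g x)
  Deg<-- n df dg = Deg<-+ n df (Deg<-neg n dg)

  Deg<-*ˡ : ∀ n k {f : Fn1} → Deg< n f → Deg< n (λ x → k * f x)
  Deg<-*ˡ zero    k df x = trans (*-congˡ (df x)) (zeroʳ k)
  Deg<-*ˡ (suc n) k {f} df = Deg<-cong n (λ x → sym (Δ-*ˡ k f x)) (Deg<-*ˡ n k df)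

  Deg<-*ʳ : ∀ n k {f : Fn1} → Deg< n f → Deg< n (λ x → f x * k)
  Deg<-*ʳ n k df = Deg<-cong n (λ x → *-comm k _) (Deg<-*ˡ n k df)

  Deg<-shift : ∀ n s {f : Fn1} → Deg< n f → Deg< n (λ x → f (x ℤ.+ s))
  Deg<-shift zero    s df x = df (x ℤ.+ s)
  Deg<-shift (suc n) s {f} df = Deg<-cong n (λ x → +-congʳ (reflexive (≡.cong f (suc-+ x s))))
                                           (Deg<-shift n s df)
    where
    suc-+ : ∀ x s → x ℤ.+ s ℤ.+ 1ℤ ≡ x ℤ.+ 1ℤ ℤ.+ s
    suc-+ = solve-∀

  Deg<-const : ∀ k → Deg< 1 (λ _ → k)
  Deg<-const k x = -‿inverseʳ k

  Deg<-sumℕ : ∀ n N (f : ℕ → Fn1) → (∀ i → i ℕ.< N → Deg< n (f i)) →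
              Deg< n (λ x → sumℕ N (λ i → f i x))
  Deg<-sumℕ n zero    f df = Deg<-zero n (λ _ → refl)
  Deg<-sumℕ n (suc N) f df = Deg<-+ n (df 0 (s≤s z≤n))
                                       (Deg<-sumℕ n N (λ i → f (suc i)) (λ i i<N → df (suc i) (s≤s i<N)))

  Deg<-sumℕ² : ∀ n M (L : ℕ → ℕ) (h : ℕ → ℕ → Fn1) → (∀ i j → i ℕ.< M → j ℕ.< L i → Deg< n (h i j)) →
               Deg< n (λ x → sumℕ M (λ i → sumℕ (L i) (λ j → h i j x)))
  Deg<-sumℕ² n M L h dh = Deg<-sumℕ n M _ (λ i i<M → Deg<-sumℕ n (L i) _ (λ j j<L → dh i j i<M j<L))

  Deg<-sumℤ : ∀ n a b (g : ℤ → Fn1) → (∀ l → Deg< n (g l)) →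
              Deg< n (λ x → sumℤ a b (λ l → g l x))
  Deg<-sumℤ zero    a b g dg x = sumℤ-zero a b (λ l → dg l x)
  Deg<-sumℤ (suc n) a b g dg   = Deg<-cong n (λ x → sumℤ-- a b _ _)
                                             (Deg<-sumℤ n a b (λ l → Δ (g l)) dg)

  Deg<-sumℤ-upper : ∀ n a {f : Fn1} → Deg< n f → Deg< (suc n) (λ t → sumℤ a t f)
  Deg<-sumℤ-upper n a {f} df = Deg<-cong n (λ t → sym (Δ-sumℤ a f t)) (Deg<-shift n 1ℤ df)

  Deg<-sumℤ-lower : ∀ n b {f : Fn1} → Deg< n f → Deg< (suc n) (λ t → sumℤ t b f)
  Deg<-sumℤ-lower n b {f} df = Deg<-cong (suc n) (λ t → sym (sumℤ-split b t b f))
    (Deg<-- (suc n) (Deg<-mono {1} {suc n} (s≤s z≤n) (Deg<-const (sumℤ b b f)))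
                    (Deg<-shift (suc n) (ℤ.- 1ℤ) (Deg<-sumℤ-upper n b df)))

  Deg<-* : ∀ m n {f g : Fn1} → Deg< (suc m) f → Deg< (suc n) g →
           Deg< (suc (m ℕ.+ n)) (λ x → f x * g x)
  Deg<-* m n {f} {g} df dg =
    Deg<-cong (m ℕ.+ n) (λ x → sym (Δ-* x)) (Deg<-+ (m ℕ.+ n) (left m df) (right n dg))
    where
    Δ-* : ∀ x → Δ (λ y → f y * g y) x ≈ Δ f x * g x + f (x ℤ.+ 1ℤ) * Δ g x
    Δ-* x = solve 4 (λ a b c d → a :* c :- b :* d := (a :- b) :* d :+ a :* (c :- d)) refl _ _ _ _
    left : ∀ m → Deg< (suc m) f → Deg< (m ℕ.+ n) (λ x → Δ f x * g x)
    left zero     df = Deg<-zero n (λ x → trans (*-congʳ (df x)) (zeroˡ _))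
    left (suc m)  df = Deg<-* m n df dg
    right : ∀ n → Deg< (suc n) g → Deg< (m ℕ.+ n) (λ x → f (x ℤ.+ 1ℤ) * Δ g x)
    right zero    dg = Deg<-zero (m ℕ.+ 0) (λ x → trans (*-congˡ (dg x)) (zeroʳ _))
    right (suc n) dg = ≡.subst (λ k → Deg< k (λ x → f (x ℤ.+ 1ℤ) * Δ g x)) (≡.sym (ℕP.+-suc m n))
                               (Deg<-* m n (Deg<-shift (suc m) 1ℤ df) dg)

  Deg<-ι : Deg< 2 ι
  Deg<-ι = Deg<-cong 1 (λ x → sym (trans (+-congʳ (ι-suc x)) (solve 1 (λ a → a :+ con (+ 1) :- a := con (+ 1)) refl _)))
                       (Deg<-const 1#)

  Deg<-pow : ∀ i → Deg< (suc i) (λ x → pow (ι x) i)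
  Deg<-pow zero    = Deg<-const 1#
  Deg<-pow (suc i) = Deg<-* 1 i Deg<-ι (Deg<-pow i)

module Interpolation {c ℓ} (R : CommutativeRing c ℓ) (q : Poly.QAlgebra R) where
  open CommutativeRing R
  open Poly R using (ιℕ; ι; pow; sumℕ; Fn3; DegK₂≤)
  open IntegerCoefficients R
  open FiniteSums R
  open Differences R
  open Degree R
  open import Relation.Binary.Reasoning.Setoid setoid

  private
    inv : ℕ → Carrier
    inv = proj₁ q

    cancel : ∀ k {u v} → ιℕ (suc k) * u ≈ ιℕ (suc k) * v → u ≈ v
    cancel k {u} {v} eq = begin
      u                             ≈⟨ *-identityˡ u ⟨
      1# * u                        ≈⟨ *-congʳ (proj₂ q k) ⟨
      inv k * ιℕ (suc k) * u        ≈⟨ *-assoc _ _ _ ⟩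
      inv k * (ιℕ (suc k) * u)      ≈⟨ *-congˡ eq ⟩
      inv k * (ιℕ (suc k) * v)      ≈⟨ *-assoc _ _ _ ⟨
      inv k * ιℕ (suc k) * v        ≈⟨ *-congʳ (proj₂ q k) ⟩
      1# * v                        ≈⟨ *-identityˡ v ⟩
      v                             ∎

  binomial : ℕ → Fn1
  binomial zero    x = 1#
  binomial (suc k) x = inv k * (binomial k x * (ι x - ιℕ k))

  binomial-suc : ∀ k x → ιℕ (suc k) * binomial (suc k) x ≈ binomial k x * (ι x - ιℕ k)
  binomial-suc k x = begin
    ιℕ (suc k) * (inv k * w)      ≈⟨ *-assoc _ _ _ ⟨
    (ιℕ (suc k) * inv k) * w      ≈⟨ *-congʳ (trans (*-comm _ _) (proj₂ q k)) ⟩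
    1# * w                        ≈⟨ *-identityˡ w ⟩
    w                             ∎
    where w = binomial k x * (ι x - ιℕ k)

  binomial-zero : ∀ k → binomial (suc k) 0ℤ ≈ 0#
  binomial-zero zero    = trans (*-congˡ (trans (*-identityˡ _) (-‿inverseʳ 0#))) (zeroʳ _)
  binomial-zero (suc k) = trans (*-congˡ (trans (*-congʳ (binomial-zero k)) (zeroˡ _))) (zeroʳ _)

  Δ-binomial : ∀ k x → Δ (binomial (suc k)) x ≈ binomial k x
  Δ-binomial k x = cancel k (begin
    K₁ * (binomial (suc k) (x ℤ.+ 1ℤ) - binomial (suc k) x)
      ≈⟨ solve 3 (λ p a b → p :* (a :- b) := p :* a :- p :* b) refl _ _ _ ⟩
    K₁ * binomial (suc k) (x ℤ.+ 1ℤ) - K₁ * binomial (suc k) x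
      ≈⟨ +-cong (binomial-suc k _) (-‿cong (binomial-suc k x)) ⟩
    binomial k (x ℤ.+ 1ℤ) * (ι (x ℤ.+ 1ℤ) - ιℕ k) - binomial k x * (ι x - ιℕ k)
      ≈⟨ +-congʳ (*-congˡ (+-congʳ (ι-suc x))) ⟩
    binomial k (x ℤ.+ 1ℤ) * (ι x + 1# - ιℕ k) - binomial k x * (ι x - ιℕ k)
      ≈⟨ scaled k ⟩
    K₁ * binomial k x ∎)
    where
    K₁ = ιℕ (suc k)
    scaled : ∀ k → binomial k (x ℤ.+ 1ℤ) * (ι x + 1# - ιℕ k) - binomial k x * (ι x - ιℕ k)
                   ≈ ιℕ (suc k) * binomial k x
    scaled zero = solve 1 (λ X → con (+ 1) :* (X :+ con (+ 1) :- con (+ 0)) :- con (+ 1) :* (X :- con (+ 0))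
                                 := (con (+ 1) :+ con (+ 0)) :* con (+ 1)) refl (ι x)
    scaled (suc k) = begin
      binomial (suc k) (x ℤ.+ 1ℤ) * (X + 1# - (1# + K)) - B * (X - (1# + K))
        ≈⟨ +-congʳ (*-congʳ (trans (solve 2 (λ a b → a := b :+ (a :- b)) refl _ _)
                                   (+-congˡ (Δ-binomial k x)))) ⟩
      (B + B') * (X + 1# - (1# + K)) - B * (X - (1# + K))
        ≈⟨ solve 4 (λ B B' X K → (B :+ B') :* (X :+ con (+ 1) :- (con (+ 1) :+ K)) :- B :* (X :- (con (+ 1) :+ K))
                                 := B :+ B' :* (X :- K)) refl B B' X K ⟩
      B + B' * (X - K)
        ≈⟨ +-congˡ (binomial-suc k x) ⟨
      B + (1# + K) * B
        ≈⟨ solve 2 (λ B K → B :+ (con (+ 1) :+ K) :* B := (con (+ 1) :+ (con (+ 1) :+ K)) :* B) refl B K ⟩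
      (1# + (1# + K)) * B ∎
      where
      B  = binomial (suc k) x
      B' = binomial k x
      X  = ι x
      K  = ιℕ k

  Δ^ : ℕ → Fn1 → Fn1
  Δ^ zero    f = f
  Δ^ (suc k) f = Δ^ k (Δ f)

  newton : ∀ n f → Deg< n f → ∀ x → f x ≈ sumℕ n (λ k → binomial k x * Δ^ k f 0ℤ)
  newton zero    f df = df
  newton (suc n) f df = Δ-unique 0ℤ Δf≈ΔN f0≈N0
    where
    N : Fn1
    N x = sumℕ (suc n) (λ k → binomial k x * Δ^ k f 0ℤ)
    S : Fn1
    S x = sumℕ n (λ k → binomial (suc k) x * Δ^ k (Δ f) 0ℤ)
    Δf≈ΔN : ∀ x → Δ f x ≈ Δ N x
    Δf≈ΔN x = sym (begin
      (1# * f 0ℤ + S (x ℤ.+ 1ℤ)) - (1# * f 0ℤ + S x)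
        ≈⟨ solve 3 (λ a b c → (a :+ b) :- (a :+ c) := b :- c) refl _ _ _ ⟩
      S (x ℤ.+ 1ℤ) - S x
        ≈⟨ sumℕ-- n _ _ ⟨
      sumℕ n (λ k → binomial (suc k) (x ℤ.+ 1ℤ) * Δ^ k (Δ f) 0ℤ - binomial (suc k) x * Δ^ k (Δ f) 0ℤ)
        ≈⟨ sumℕ-cong n (λ k → trans (solve 3 (λ a b c → a :* c :- b :* c := (a :- b) :* c) refl _ _ _)
                                     (*-congʳ (Δ-binomial k x))) ⟩
      sumℕ n (λ k → binomial k x * Δ^ k (Δ f) 0ℤ)
        ≈⟨ newton n (Δ f) df x ⟨
      Δ f x ∎)
    f0≈N0 : f 0ℤ ≈ N 0ℤ
    f0≈N0 = sym (trans (+-cong (*-identityˡ _)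
                               (sumℕ-zero n (λ k → trans (*-congʳ (binomial-zero k)) (zeroˡ _))))
                       (+-identityʳ _))

  binomial-poly : ℕ → ℕ → Carrier
  binomial-poly zero    zero    = 1#
  binomial-poly zero    (suc a) = 0#
  binomial-poly (suc k) zero    = inv k * - (ιℕ k * binomial-poly k 0)
  binomial-poly (suc k) (suc a) = inv k * (binomial-poly k a - ιℕ k * binomial-poly k (suc a))

  binomial-monomials : ∀ k M → k ℕ.< M → ∀ x →
                       binomial k x ≈ sumℕ M (λ a → binomial-poly k a * pow (ι x) a)
  binomial-monomials zero (suc M) _ x = sym (begin
    1# * 1# + sumℕ M (λ a → 0# * pow (ι x) (suc a)) ≈⟨ +-cong (*-identityˡ 1#) (sumℕ-zero M (λ a → zeroˡ _)) ⟩
    1# + 0#                                         ≈⟨ +-identityʳ 1# ⟩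
    1#                                              ∎)
  binomial-monomials (suc k) (suc M) (s≤s k<M) x = sym (begin
    inv k * - (K * γ 0) * 1# + sumℕ M (λ a → inv k * (γ a - K * γ (suc a)) * (X * pow X a))
      ≈⟨ +-congˡ (sumℕ-cong M (λ a → *-assoc _ _ _)) ⟩
    inv k * - (K * γ 0) * 1# + sumℕ M (λ a → inv k * ((γ a - K * γ (suc a)) * (X * pow X a)))
      ≈⟨ +-congˡ (sumℕ-*ˡ M (inv k) _) ⟩
    inv k * - (K * γ 0) * 1# + inv k * sumℕ M (λ a → (γ a - K * γ (suc a)) * (X * pow X a))
      ≈⟨ +-congˡ (*-congˡ (sumℕ-cong M (λ a → split (γ a) (γ (suc a)) (pow X a)))) ⟩
    inv k * - (K * γ 0) * 1# + inv k * sumℕ M (λ a → X * (γ a * pow X a) - K * (γ (suc a) * (X * pow X a)))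
      ≈⟨ +-congˡ (*-congˡ (trans (sumℕ-- M _ _) (+-cong (sumℕ-*ˡ M X _) (-‿cong (sumℕ-*ˡ M K _))))) ⟩
    inv k * - (K * γ 0) * 1# + inv k * (X * P M - K * T)
      ≈⟨ solve 6 (λ i K g0 X P T → i :* :- (K :* g0) :* con (+ 1) :+ i :* (X :* P :- K :* T)
                                   := i :* (X :* P :- K :* (g0 :* con (+ 1) :+ T))) refl (inv k) K (γ 0) X (P M) T ⟩
    inv k * (X * P M - K * P (suc M))
      ≈⟨ *-congˡ (+-cong (*-congˡ (sym (binomial-monomials k M k<M x)))
                         (-‿cong (*-congˡ (sym (binomial-monomials k (suc M) (ℕP.m<n⇒m<1+n k<M) x))))) ⟩
    inv k * (X * B - K * B)
      ≈⟨ *-congˡ (solve 3 (λ X B K → X :* B :- K :* B := B :* (X :- K)) refl X B K) ⟩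
    binomial (suc k) x ∎)
    where
    γ = binomial-poly k
    X = ι x
    K = ιℕ k
    B = binomial k x
    P : ℕ → Carrier
    P m = sumℕ m (λ a → γ a * pow X a)
    T = sumℕ M (λ a → γ (suc a) * (X * pow X a))
    split : ∀ g g' p → (g - K * g') * (X * p) ≈ X * (g * p) - K * (g' * (X * p))
    split g g' p = solve 5 (λ g g' p X K → (g :- K :* g') :* (X :* p) := X :* (g :* p) :- K :* (g' :* (X :* p)))
                           refl g g' p X K

  coefficient : ℕ → Fn1 → ℕ → Carrier
  coefficient n f a = sumℕ n (λ k → Δ^ k f 0ℤ * binomial-poly k a)

  Deg<⇒monomials : ∀ n f → Deg< n f → ∀ x → f x ≈ sumℕ n (λ a → coefficient n f a * pow (ι x) a)
  Deg<⇒monomials n f df x = begin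
    f x                                                               ≈⟨ newton n f df x ⟩
    sumℕ n (λ k → binomial k x * Δ^ k f 0ℤ)                          ≈⟨ sumℕ-cong-< n expand ⟩
    sumℕ n (λ k → sumℕ n (λ a → Δ^ k f 0ℤ * binomial-poly k a * pow (ι x) a))
                                                                      ≈⟨ sumℕ-swap n n _ ⟩
    sumℕ n (λ a → sumℕ n (λ k → Δ^ k f 0ℤ * binomial-poly k a * pow (ι x) a))
                                                                      ≈⟨ sumℕ-cong n (λ a → sumℕ-*ʳ n _ _) ⟩
    sumℕ n (λ a → coefficient n f a * pow (ι x) a)                   ∎
    where
    expand : ∀ k → k ℕ.< n → binomial k x * Δ^ k f 0ℤ ≈
                              sumℕ n (λ a → Δ^ k f 0ℤ * binomial-poly k a * pow (ι x) a)
    expand k k<n = begin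
      binomial k x * Δ^ k f 0ℤ
        ≈⟨ *-comm _ _ ⟩
      Δ^ k f 0ℤ * binomial k x
        ≈⟨ *-congˡ (binomial-monomials k n k<n x) ⟩
      Δ^ k f 0ℤ * sumℕ n (λ a → binomial-poly k a * pow (ι x) a)
        ≈⟨ sumℕ-*ˡ n _ _ ⟨
      sumℕ n (λ a → Δ^ k f 0ℤ * (binomial-poly k a * pow (ι x) a))
        ≈⟨ sumℕ-cong n (λ a → sym (*-assoc _ _ _)) ⟩
      sumℕ n (λ a → Δ^ k f 0ℤ * binomial-poly k a * pow (ι x) a) ∎

  Deg<-Δ^ : ∀ m (H : ℤ → Fn1) → (∀ x → Deg< m (H x)) → ∀ k x₀ → Deg< m (λ y → Δ^ k (λ x → H x y) x₀)
  Deg<-Δ^ m H dH zero    x₀ = dH x₀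
  Deg<-Δ^ m H dH (suc k) x₀ = Deg<-Δ^ m (λ x y → H (x ℤ.+ 1ℤ) y - H x y) (λ x → Deg<-- m (dH _) (dH x)) k x₀

  Deg<-coefficient : ∀ m n (H : ℤ → Fn1) → (∀ x → Deg< m (H x)) →
                     ∀ a → Deg< m (λ y → coefficient n (λ x → H x y) a)
  Deg<-coefficient m n H dH a =
    Deg<-sumℕ m n _ (λ k _ → Deg<-*ʳ m _ (Deg<-Δ^ m H dH k 0ℤ))

  Deg<²⇒monomials : ∀ M N (H : ℤ → ℤ → Carrier) → (∀ z → Deg< M (λ y → H y z)) → (∀ y → Deg< N (H y)) →
                    ∀ y z → H y z ≈ sumℕ M (λ j → sumℕ N (λ k →
                      coefficient N (λ z → coefficient M (λ y → H y z) j) k * pow (ι y) j * pow (ι z) k))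
  Deg<²⇒monomials M N H dy dz y z = begin
    H y z
      ≈⟨ Deg<⇒monomials M (λ y → H y z) (dy z) y ⟩
    sumℕ M (λ j → γ j z * Y j)
      ≈⟨ sumℕ-cong M (λ j → *-congʳ {Y j} (Deg<⇒monomials N (γ j) (Deg<-coefficient N M H dz j) z)) ⟩
    sumℕ M (λ j → sumℕ N (λ k → coefficient N (γ j) k * Z k) * Y j)
      ≈⟨ sumℕ-cong M (λ j → trans (sym (sumℕ-*ʳ N (Y j) _)) (sumℕ-cong N (λ k →
           solve 3 (λ b z y → b :* z :* y := b :* y :* z) refl (coefficient N (γ j) k) (Z k) (Y j)))) ⟩
    sumℕ M (λ j → sumℕ N (λ k → coefficient N (γ j) k * Y j * Z k)) ∎
    where
    γ : ℕ → Fn1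
    γ j z = coefficient M (λ y → H y z) j
    Y = λ j → pow (ι y) j
    Z = λ k → pow (ι z) k

  Deg<³⇒DegK₂≤ : ∀ N d (G : Fn3) →
                 (∀ y z → Deg< N (λ x → G x y z)) → (∀ x z → Deg< (suc d) (λ y → G x y z)) →
                 (∀ x y → Deg< N (G x y)) → DegK₂≤ d G
  Deg<³⇒DegK₂≤ N d G dx dy dz = N , b , expansion
    where
    γ : ℕ → ℤ → ℤ → Carrier
    γ i y z = coefficient N (λ x → G x y z) i
    b : ℕ → ℕ → ℕ → Carrier
    b i j k = coefficient N (λ z → coefficient (suc d) (λ y → γ i y z) j) k
    expansion : ∀ k₁ k₂ k₃ → G k₁ k₂ k₃ ≈ sumℕ N (λ i → sumℕ (suc d) λ j → sumℕ N λ k →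
                                          b i j k * pow (ι k₁) i * pow (ι k₂) j * pow (ι k₃) k)
    expansion k₁ k₂ k₃ = begin
      G k₁ k₂ k₃
        ≈⟨ Deg<⇒monomials N (λ x → G x k₂ k₃) (dx k₂ k₃) k₁ ⟩
      sumℕ N (λ i → γ i k₂ k₃ * X i)
        ≈⟨ sumℕ-cong N (λ i → *-congʳ {X i} (Deg<²⇒monomials (suc d) N (γ i)
             (λ z → Deg<-coefficient (suc d) N (λ x y → G x y z) (λ x → dy x z) i)
             (λ y → Deg<-coefficient N N (λ x z → G x y z) (λ x → dz x y) i) k₂ k₃)) ⟩
      sumℕ N (λ i → sumℕ (suc d) (λ j → sumℕ N (λ k → b i j k * Y j * Z k)) * X i)
        ≈⟨ sumℕ-cong N (λ i → trans (sumℕ²-*ʳ (suc d) N (X i) (λ j k → b i j k * Y j * Z k)) (sumℕ-cong (suc d) (λ j → sumℕ-cong N (λ k →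
             solve 4 (λ b y z x → b :* y :* z :* x := b :* x :* y :* z) refl (b i j k) (Y j) (Z k) (X i))))) ⟩
      sumℕ N (λ i → sumℕ (suc d) λ j → sumℕ N λ k → b i j k * X i * Y j * Z k) ∎
      where
      X = λ i → pow (ι k₁) i
      Y = λ j → pow (ι k₂) j
      Z = λ k → pow (ι k₃) k

module TwoVariables {c ℓ} (R : CommutativeRing c ℓ) where
  open CommutativeRing R
  open Poly R
  open IntegerCoefficients R
  open FiniteSums R
  open Degree R
  open import Relation.Binary.Reasoning.Setoid setoid

  Deg<ˣʸ : ℕ → Fn2 → Set ℓ
  Deg<ˣʸ n F = (∀ y → Deg< n (λ x → F x y)) × (∀ x → Deg< n (F x))

  Deg<ˣʸ-D : ∀ n {F} → Deg<ˣʸ (suc n) F → Deg<ˣʸ n (D F)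
  Deg<ˣʸ-D n {F} (dx , dy) =
    (λ y → Deg<-+ n (Deg<-shift n (ℤ.- 1ℤ) (mixed-x y)) (mixed-x (y ℤ.- 1ℤ))) ,
    (λ x → Deg<-+ n (mixed-y (x ℤ.- 1ℤ)) (Deg<-shift n (ℤ.- 1ℤ) (mixed-y x)))
    where
    mixed-x : ∀ y → Deg< n (λ x → Δx (Δy F) x y)
    mixed-x y = Deg<-cong n (λ x → solve 4 (λ a b c d → (a :- b) :- (c :- d) := (a :- c) :- (b :- d)) refl _ _ _ _)
                            (Deg<-- n (dx (y ℤ.+ 1ℤ)) (dx y))
    mixed-y : ∀ x → Deg< n (Δx (Δy F) x)
    mixed-y x = Deg<-- n (dy (x ℤ.+ 1ℤ)) (dy x)

  Deg<ˣʸ-suc : ∀ n {F} → Deg<ˣʸ n F → Deg<ˣʸ (suc n) F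
  Deg<ˣʸ-suc n (dx , dy) = (λ y → Deg<-mono (ℕP.n≤1+n n) (dx y)) , (λ x → Deg<-mono (ℕP.n≤1+n n) (dy x))

  Deg<ˣʸ-iter-D : ∀ n k {F} → Deg<ˣʸ n F → Deg<ˣʸ n (iter k D F)
  Deg<ˣʸ-iter-D n zero    dF = dF
  Deg<ˣʸ-iter-D n (suc k) dF = Deg<ˣʸ-D n (Deg<ˣʸ-suc n (Deg<ˣʸ-iter-D n k dF))

  Deg<ˣʸ-iter-D-lowers : ∀ k n {F} → Deg<ˣʸ (k ℕ.+ n) F → Deg<ˣʸ n (iter k D F)
  Deg<ˣʸ-iter-D-lowers zero    n dF = dF
  Deg<ˣʸ-iter-D-lowers (suc k) n {F} dF =
    Deg<ˣʸ-D n (Deg<ˣʸ-iter-D-lowers k (suc n) (≡.subst (λ m → Deg<ˣʸ m F) (≡.sym (ℕP.+-suc k n)) dF))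

  iter-D-vanishes : ∀ k {F} → Deg<ˣʸ k F → ∀ x y → iter k D F x y ≈ 0#
  iter-D-vanishes k {F} dF x y =
    proj₁ (Deg<ˣʸ-iter-D-lowers k 0 (≡.subst (λ m → Deg<ˣʸ m F) (≡.sym (ℕP.+-identityʳ k)) dF)) y x

  Deg<ˣʸ-combination : ∀ n N (s : ℕ → Carrier) (F : ℕ → Fn2) → (∀ k → Deg<ˣʸ n (F k)) →
                       Deg<ˣʸ n (λ x y → sumℕ N (λ k → s k * F k x y))
  Deg<ˣʸ-combination n N s F dF =
    (λ y → Deg<-sumℕ n N _ (λ k _ → Deg<-*ˡ n (s k) (proj₁ (dF k) y))) ,
    (λ x → Deg<-sumℕ n N _ (λ k _ → Deg<-*ˡ n (s k) (proj₂ (dF k) x)))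

  Deg<ˣʸ-Winv : ∀ q n N {F} → Deg<ˣʸ n F → Deg<ˣʸ n (Winv q N F)
  Deg<ˣʸ-Winv q n N {F} dF = Deg<ˣʸ-combination n N _ (λ k → iter k D F) (λ k → Deg<ˣʸ-iter-D n k dF)

  D-combination : ∀ N (s : ℕ → Carrier) (F : ℕ → Fn2) x y →
                  D (λ x y → sumℕ N (λ k → s k * F k x y)) x y ≈ sumℕ N (λ k → s k * D (F k) x y)
  D-combination N s F x y = trans (+-cong (mixed _ _) (mixed _ _))
    (trans (sym (sumℕ-+ N _ _)) (sumℕ-cong N (λ k → sym (distribˡ (s k) _ _))))
    where
    combination-- : ∀ (u v : ℕ → Carrier) →
                    sumℕ N (λ k → s k * u k) - sumℕ N (λ k → s k * v k) ≈ sumℕ N (λ k → s k * (u k - v k))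
    combination-- u v = trans (sym (sumℕ-- N _ _))
      (sumℕ-cong N (λ k → solve 3 (λ s u v → s :* u :- s :* v := s :* (u :- v)) refl (s k) (u k) (v k)))
    mixed : ∀ p p' → Δx (Δy (λ x y → sumℕ N (λ k → s k * F k x y))) p p' ≈
                     sumℕ N (λ k → s k * Δx (Δy (F k)) p p')
    mixed p p' = trans (+-cong (combination-- _ _) (-‿cong (combination-- _ _))) (combination-- _ _)

  Winv-inverse : ∀ q N F → (∀ x y → iter N D F x y ≈ 0#) → ∀ x y →
                 (Winv q N F x y + Winv q N F x y) + D (Winv q N F) x y ≈ F x y
  Winv-inverse q@(inv , inv-correct) N F D^NF≈0 x y = begin
    (W x y + W x y) + D W x y
      ≈⟨ +-cong (sym (sumℕ-+ N _ _)) (D-combination N s (λ k → iter k D F) x y) ⟩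
    sumℕ N (λ k → s k * iter k D F x y + s k * iter k D F x y) + sumℕ N (λ k → s k * D (iter k D F) x y)
      ≈⟨ sumℕ-+ N _ _ ⟨
    sumℕ N (λ k → (s k * iter k D F x y + s k * iter k D F x y) + s k * D (iter k D F) x y)
      ≈⟨ sumℕ-cong N (λ k → step (pow (- h) k) (iter k D F x y) (D (iter k D F) x y)) ⟩
    sumℕ N (λ k → a k - a (suc k))
      ≈⟨ sumℕ-telescope N a ⟩
    a 0 - a N
      ≈⟨ +-cong (*-identityˡ _) (-‿cong (trans (*-congˡ (D^NF≈0 x y)) (zeroʳ _))) ⟩
    F x y - 0#
      ≈⟨ solve 1 (λ u → u :- con (+ 0) := u) refl _ ⟩
    F x y ∎
    where
    W = Winv q N F
    h = inv 1
    s : ℕ → Carrier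
    s k = pow (- h) k * h
    a : ℕ → Carrier
    a k = pow (- h) k * iter k D F x y
    h+h≈1 : h + h ≈ 1#
    h+h≈1 = trans (solve 1 (λ h → h :+ h := h :* (con (+ 1) :+ (con (+ 1) :+ con (+ 0)))) refl h) (inv-correct 1)
    step : ∀ P u v → (P * h * u + P * h * u) + P * h * v ≈ P * u - (- h * P) * v
    step P u v = begin
      (P * h * u + P * h * u) + P * h * v
        ≈⟨ solve 4 (λ P h u v → (P :* h :* u :+ P :* h :* u) :+ P :* h :* v
                                := P :* u :* (h :+ h) :- (:- h :* P) :* v) refl P h u v ⟩
      P * u * (h + h) - (- h * P) * v
        ≈⟨ +-congʳ (trans (*-congˡ h+h≈1) (*-identityʳ _)) ⟩
      P * u - (- h * P) * v ∎

  Deg<ˣʸ-polyA : ∀ r a → Deg<ˣʸ (suc r) (polyA r a)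
  Deg<ˣʸ-polyA r a =
    (λ y → Deg<-sumℕ² (suc r) (suc r) (λ _ → suc r) _ (λ i j i<1+r _ →
             Deg<-*ʳ (suc r) (pow (ι y) j) (Deg<-*ˡ (suc r) (a i j) (Deg<-mono i<1+r (Deg<-pow i))))) ,
    (λ x → Deg<-sumℕ² (suc r) (suc r) (λ _ → suc r) _ (λ i j _ j<1+r →
             Deg<-*ˡ (suc r) (a i j * pow (ι x) i) (Deg<-mono j<1+r (Deg<-pow j))))

  antisym : Fn2 → Fn2
  antisym φ x y = φ x y - φ y x

  skew : Fn2 → Fn2
  skew G = antisym (λ x y → G (x ℤ.+ 1ℤ) y)

  Deg<ˣʸ-skew : ∀ n {G} → Deg<ˣʸ n G → Deg<ˣʸ n (skew G)
  Deg<ˣʸ-skew n (dx , dy) = (λ y → Deg<-- n (Deg<-shift n 1ℤ (dx y)) (dy (y ℤ.+ 1ℤ))) ,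
                            (λ x → Deg<-- n (dy (x ℤ.+ 1ℤ)) (Deg<-shift n 1ℤ (dx x)))

  staircase : Fn2 → Fn2
  staircase α x y = (α x y - α x (y ℤ.- 1ℤ)) + α (x ℤ.- 1ℤ) (y ℤ.- 1ℤ)

  -- For G = Winv q N A, the first summand on the right is T q N A x y.
  V-decomposition : ∀ G x y → (G x y + G x y) + D G x y ≈
                    (Vxy G x y + Vxy G (y ℤ.+ 1ℤ) (x ℤ.- 1ℤ)) + staircase (skew G) x y
  V-decomposition G x y = begin
    (g₀ + g₀) + D G x y
      ≈⟨ +-congˡ (+-cong (K-predˣ x y) (K-predʸ x y)) ⟩
    (g₀ + g₀) + (((a - g₀) - (b - h)) + ((d - e) - (g₀ - f)))
      ≈⟨ solve 11 (λ g₀ a b h d e f u v w z →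
           (g₀ :+ g₀) :+ (((a :- g₀) :- (b :- h)) :+ ((d :- e) :- (g₀ :- f)))
           := ((g₀ :+ ((a :- g₀) :- (b :- h))) :+ (u :+ ((v :- u) :- (w :- z))))
              :+ (((d :- v) :- (e :- w)) :+ (f :- z))) refl g₀ a b h d e f u v w z ⟩
    ((g₀ + ((a - g₀) - (b - h))) + (u + ((v - u) - (w - z)))) + (((d - v) - (e - w)) + (f - z))
      ≈⟨ +-cong (+-cong (+-congˡ (sym (K-predˣ x y))) (+-congˡ (sym K-swapped))) (sym staircase-skew) ⟩
    (Vxy G x y + Vxy G (y ℤ.+ 1ℤ) (x ℤ.- 1ℤ)) + staircase (skew G) x y ∎
    where
    pred-suc : ∀ x → x ℤ.- 1ℤ ℤ.+ 1ℤ ≡ x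
    pred-suc = solve-∀
    suc-pred : ∀ x → x ℤ.+ 1ℤ ℤ.- 1ℤ ≡ x
    suc-pred = solve-∀
    at : ∀ {x x' y y'} → x ≡ x' → y ≡ y' → G x y ≈ G x' y'
    at x≡x' y≡y' = reflexive (≡.cong₂ G x≡x' y≡y')
    K = Δx (Δy G)
    g₀ = G x y
    a  = G x (y ℤ.+ 1ℤ)
    b  = G (x ℤ.- 1ℤ) (y ℤ.+ 1ℤ)
    h  = G (x ℤ.- 1ℤ) y
    d  = G (x ℤ.+ 1ℤ) y
    e  = G (x ℤ.+ 1ℤ) (y ℤ.- 1ℤ)
    f  = G x (y ℤ.- 1ℤ)
    u  = G (y ℤ.+ 1ℤ) (x ℤ.- 1ℤ)
    v  = G (y ℤ.+ 1ℤ) x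
    w  = G y x
    z  = G y (x ℤ.- 1ℤ)
    K-predˣ : ∀ x y → K (x ℤ.- 1ℤ) y ≈ (G x (y ℤ.+ 1ℤ) - G x y) - (G (x ℤ.- 1ℤ) (y ℤ.+ 1ℤ) - G (x ℤ.- 1ℤ) y)
    K-predˣ x y = +-congʳ (+-cong (at (pred-suc x) ≡.refl) (-‿cong (at (pred-suc x) ≡.refl)))
    K-predʸ : ∀ x y → K x (y ℤ.- 1ℤ) ≈ (G (x ℤ.+ 1ℤ) y - G (x ℤ.+ 1ℤ) (y ℤ.- 1ℤ)) - (G x y - G x (y ℤ.- 1ℤ))
    K-predʸ x y = +-cong (+-congʳ (at ≡.refl (pred-suc y))) (-‿cong (+-congʳ (at ≡.refl (pred-suc y))))
    K-swapped : K (y ℤ.+ 1ℤ ℤ.- 1ℤ) (x ℤ.- 1ℤ) ≈ (v - u) - (w - z)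
    K-swapped = trans (reflexive (≡.cong (λ t → K t (x ℤ.- 1ℤ)) (suc-pred y))) (K-predʸ y x)
    staircase-skew : staircase (skew G) x y ≈ ((d - v) - (e - w)) + (f - z)
    staircase-skew = +-cong (+-congˡ (-‿cong (+-congˡ (-‿cong (at (pred-suc y) ≡.refl)))))
                            (+-cong (at (pred-suc x) ≡.refl) (-‿cong (at (pred-suc y) ≡.refl)))

module DoubleSums {c ℓ} (R : CommutativeRing c ℓ) where
  open CommutativeRing R
  open Poly R
  open IntegerCoefficients R
  open FiniteSums R
  open Differences R
  open IntervalSums R
  open Degree R
  open TwoVariables R
  open import Relation.Binary.Reasoning.Setoid setoid

  doubleSum-cong : ∀ {F G : Fn2} → (∀ x y → F x y ≈ G x y) →
                   ∀ k₁ k₂ k₃ → doubleSum F k₁ k₂ k₃ ≈ doubleSum G k₁ k₂ k₃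
  doubleSum-cong F≈G k₁ k₂ k₃ =
    +-cong (sumℤ-cong k₁ k₂ (λ l₁ → sumℤ-cong k₂ k₃ (F≈G l₁))) (-‿cong (F≈G k₂ k₂))

  doubleSum-+ : ∀ F G k₁ k₂ k₃ → doubleSum (F ⊕ G) k₁ k₂ k₃ ≈ doubleSum F k₁ k₂ k₃ + doubleSum G k₁ k₂ k₃
  doubleSum-+ F G k₁ k₂ k₃ = begin
    sumℤ k₁ k₂ (λ l₁ → sumℤ k₂ k₃ (λ l₂ → F l₁ l₂ + G l₁ l₂)) - (F k₂ k₂ + G k₂ k₂)
      ≈⟨ +-congʳ (trans (sumℤ-cong k₁ k₂ (λ l₁ → sumℤ-+ k₂ k₃ (F l₁) (G l₁))) (sumℤ-+ k₁ k₂ _ _)) ⟩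
    (ΣΣ F + ΣΣ G) - (F k₂ k₂ + G k₂ k₂)
      ≈⟨ solve 4 (λ a b c d → (a :+ b) :- (c :+ d) := (a :- c) :+ (b :- d)) refl _ _ _ _ ⟩
    doubleSum F k₁ k₂ k₃ + doubleSum G k₁ k₂ k₃ ∎
    where ΣΣ = λ H → sumℤ k₁ k₂ (λ l₁ → sumℤ k₂ k₃ (H l₁))

  doubleSum-*ˡ : ∀ k F k₁ k₂ k₃ → doubleSum (k · F) k₁ k₂ k₃ ≈ k * doubleSum F k₁ k₂ k₃
  doubleSum-*ˡ k F k₁ k₂ k₃ = begin
    sumℤ k₁ k₂ (λ l₁ → sumℤ k₂ k₃ (λ l₂ → k * F l₁ l₂)) - k * F k₂ k₂
      ≈⟨ +-congʳ (trans (sumℤ-cong k₁ k₂ (λ l₁ → sumℤ-*ˡ k₂ k₃ k (F l₁))) (sumℤ-*ˡ k₁ k₂ k _)) ⟩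
    k * sumℤ k₁ k₂ (λ l₁ → sumℤ k₂ k₃ (F l₁)) - k * F k₂ k₂
      ≈⟨ solve 3 (λ k a b → k :* a :- k :* b := k :* (a :- b)) refl _ _ _ ⟩
    k * doubleSum F k₁ k₂ k₃ ∎

  doubleSum-sumℕ : ∀ N (F : ℕ → Fn2) k₁ k₂ k₃ →
                   doubleSum (λ x y → sumℕ N (λ i → F i x y)) k₁ k₂ k₃ ≈ sumℕ N (λ i → doubleSum (F i) k₁ k₂ k₃)
  doubleSum-sumℕ zero    F k₁ k₂ k₃ =
    trans (+-congʳ (sumℤ-zero k₁ k₂ (λ l₁ → sumℤ-zero k₂ k₃ (λ _ → refl)))) (-‿inverseʳ 0#)
  doubleSum-sumℕ (suc N) F k₁ k₂ k₃ =
    trans (doubleSum-+ (F 0) (λ x y → sumℕ N (λ i → F (suc i) x y)) k₁ k₂ k₃)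
          (+-congˡ (doubleSum-sumℕ N (λ i → F (suc i)) k₁ k₂ k₃))

  doubleSum-separable : ∀ (f g : Fn1) k₁ k₂ k₃ →
                        doubleSum (λ x y → f x * g y) k₁ k₂ k₃ ≈ sumℤ k₁ k₂ f * sumℤ k₂ k₃ g - f k₂ * g k₂
  doubleSum-separable f g k₁ k₂ k₃ =
    +-congʳ (trans (sumℤ-cong k₁ k₂ (λ l₁ → sumℤ-*ˡ k₂ k₃ (f l₁) g)) (sumℤ-*ʳ k₁ k₂ _ f))

  sumℤ²-antisym : ∀ φ a b → sumℤ a b (λ x → sumℤ a b (antisym φ x)) ≈ 0#
  sumℤ²-antisym φ a b = begin
    sumℤ a b (λ x → sumℤ a b (λ y → φ x y - φ y x))
      ≈⟨ sumℤ-cong a b (λ x → sumℤ-- a b (φ x) (λ y → φ y x)) ⟩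
    sumℤ a b (λ x → sumℤ a b (φ x) - sumℤ a b (λ y → φ y x))
      ≈⟨ sumℤ-- a b _ _ ⟩
    S - sumℤ a b (λ x → sumℤ a b (λ y → φ y x))
      ≈⟨ +-congˡ (-‿cong (sumℤ-swap a b a b (λ x y → φ y x))) ⟩
    S - S
      ≈⟨ -‿inverseʳ S ⟩
    0# ∎
    where S = sumℤ a b (λ x → sumℤ a b (φ x))

  sumℤ-staircase : ∀ α c l b e →
                   sumℤ b e (staircase α l) ≈
                   ((α l e + sumℤ c (e ℤ.- 1ℤ) (α (l ℤ.- 1ℤ))) - sumℤ c (b ℤ.- 1ℤ) (α (l ℤ.- 1ℤ)))
                   - (α l (b ℤ.- 1ℤ) - α (l ℤ.- 1ℤ) (b ℤ.- 1ℤ))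
  sumℤ-staircase α c l b e = begin
    sumℤ b e (staircase α l)
      ≈⟨ sumℤ-+ b e _ _ ⟩
    sumℤ b e (λ m → α l m - α l (m ℤ.- 1ℤ)) + sumℤ b e (λ m → α l' (m ℤ.- 1ℤ))
      ≈⟨ +-cong (sumℤ-telescope b e (α l)) (sumℤ-shift b e (ℤ.- 1ℤ) (α l')) ⟩
    (α l e - α l b') + sumℤ b' (e ℤ.- 1ℤ) (α l')
      ≈⟨ +-congˡ (sumℤ-split c b' (e ℤ.- 1ℤ) (α l')) ⟩
    (α l e - α l b') + (sumℤ c (e ℤ.- 1ℤ) (α l') - sumℤ c (b' ℤ.- 1ℤ) (α l'))
      ≈⟨ +-congˡ (+-congˡ (-‿cong (sumℤ-init c b' (α l')))) ⟩
    (α l e - α l b') + (sumℤ c (e ℤ.- 1ℤ) (α l') - (sumℤ c b' (α l') - α l' b'))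
      ≈⟨ solve 5 (λ p q u v q' → (p :- q) :+ (u :- (v :- q')) := ((p :+ u) :- v) :- (q :- q')) refl _ _ _ _ _ ⟩
    ((α l e + sumℤ c (e ℤ.- 1ℤ) (α l')) - sumℤ c b' (α l')) - (α l b' - α l' b') ∎
    where
    l' = l ℤ.- 1ℤ
    b' = b ℤ.- 1ℤ

  doubleSum-staircase : ∀ φ k₁ k₂ k₃ → let α = antisym φ in
    doubleSum (staircase α) k₁ k₂ k₃ ≈
    (sumℤ k₁ k₂ (λ l → α l k₃) + sumℤ (k₁ ℤ.- 1ℤ) (k₂ ℤ.- 1ℤ) (λ l → sumℤ (k₁ ℤ.- 1ℤ) (k₃ ℤ.- 1ℤ) (α l)))
    + α (k₁ ℤ.- 1ℤ) (k₂ ℤ.- 1ℤ)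
  doubleSum-staircase φ k₁ k₂ k₃ = begin
    sumℤ k₁ k₂ (λ l → sumℤ k₂ k₃ (staircase α l)) - staircase α k₂ k₂
      ≈⟨ +-cong (sumℤ-cong k₁ k₂ (λ l → sumℤ-staircase α k₁-1 l k₂ k₃)) (-‿cong corner) ⟩
    sumℤ k₁ k₂ (λ l → ((P l + U (l ℤ.- 1ℤ)) - V (l ℤ.- 1ℤ)) - (Q l - Q (l ℤ.- 1ℤ))) - - Q k₂
      ≈⟨ +-congʳ (trans (sumℤ-- k₁ k₂ _ _) (+-congʳ (trans (sumℤ-- k₁ k₂ _ _) (+-congʳ (sumℤ-+ k₁ k₂ _ _))))) ⟩
    (((ΣP + sumℤ k₁ k₂ (λ l → U (l ℤ.- 1ℤ))) - sumℤ k₁ k₂ (λ l → V (l ℤ.- 1ℤ)))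
      - sumℤ k₁ k₂ (λ l → Q l - Q (l ℤ.- 1ℤ))) - - Q k₂
      ≈⟨ +-congʳ (+-cong (+-cong (+-congˡ (sumℤ-shift k₁ k₂ (ℤ.- 1ℤ) U))
                                 (-‿cong (trans (sumℤ-shift k₁ k₂ (ℤ.- 1ℤ) V) (sumℤ²-antisym φ k₁-1 k₂-1))))
                         (-‿cong (sumℤ-telescope k₁ k₂ Q))) ⟩
    (((ΣP + sumℤ k₁-1 k₂-1 U) - 0#) - (Q k₂ - Q k₁-1)) - - Q k₂
      ≈⟨ solve 4 (λ p u q q' → ((p :+ u) :- con (+ 0)) :- (q :- q') :- :- q := (p :+ u) :+ q') refl _ _ _ _ ⟩
    (ΣP + sumℤ k₁-1 k₂-1 U) + Q k₁-1 ∎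
    where
    α = antisym φ
    k₁-1 = k₁ ℤ.- 1ℤ
    k₂-1 = k₂ ℤ.- 1ℤ
    k₃-1 = k₃ ℤ.- 1ℤ
    P Q U V : Fn1
    P l = α l k₃
    Q l = α l k₂-1
    U l = sumℤ k₁-1 k₃-1 (α l)
    V l = sumℤ k₁-1 k₂-1 (α l)
    ΣP = sumℤ k₁ k₂ P
    corner : staircase α k₂ k₂ ≈ - Q k₂
    corner = solve 3 (λ p q p' → ((p :- p) :- q) :+ (p' :- p') := :- q) refl _ _ _

  Deg<-doubleSum-staircase : ∀ n φ → Deg<ˣʸ n (antisym φ) → ∀ k₁ k₃ →
                             Deg< (suc n) (λ t → doubleSum (staircase (antisym φ)) k₁ t k₃)
  Deg<-doubleSum-staircase n φ (dx , dy) k₁ k₃ = Deg<-cong (suc n) (λ t → sym (doubleSum-staircase φ k₁ t k₃))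
    (Deg<-+ (suc n)
      (Deg<-+ (suc n)
        (Deg<-sumℤ-upper n k₁ (dx k₃))
        (Deg<-shift (suc n) (ℤ.- 1ℤ) (Deg<-sumℤ-upper n (k₁ ℤ.- 1ℤ)
          (Deg<-sumℤ n (k₁ ℤ.- 1ℤ) (k₃ ℤ.- 1ℤ) (λ m x → antisym φ x m) dx))))
      (Deg<-mono (ℕP.n≤1+n n) (Deg<-shift n (ℤ.- 1ℤ) (dy (k₁ ℤ.- 1ℤ)))))

  monomial : ℕ → ℕ → Fn2
  monomial i j x y = pow (ι x) i * pow (ι y) j

  monomials : ℕ → (ℕ → ℕ) → (ℕ → ℕ → Carrier) → Fn2
  monomials M L b x y = sumℕ M (λ i → sumℕ (L i) (λ j → b i j * pow (ι x) i * pow (ι y) j))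

  doubleSum-monomials : ∀ M L b k₁ k₂ k₃ → doubleSum (monomials M L b) k₁ k₂ k₃ ≈
                        sumℕ M (λ i → sumℕ (L i) (λ j → b i j * doubleSum (monomial i j) k₁ k₂ k₃))
  doubleSum-monomials M L b k₁ k₂ k₃ =
    trans (doubleSum-sumℕ M _ k₁ k₂ k₃) (sumℕ-cong M (λ i →
      trans (doubleSum-sumℕ (L i) _ k₁ k₂ k₃) (sumℕ-cong (L i) (λ j →
        trans (doubleSum-cong (λ x y → *-assoc (b i j) _ _) k₁ k₂ k₃) (doubleSum-*ˡ (b i j) (monomial i j) k₁ k₂ k₃)))))

  Deg<₁-doubleSum-monomial : ∀ i j k₂ k₃ → Deg< (suc (suc i)) (λ k₁ → doubleSum (monomial i j) k₁ k₂ k₃)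
  Deg<₁-doubleSum-monomial i j k₂ k₃ =
    Deg<-cong (suc (suc i)) (λ k₁ → sym (doubleSum-separable X Y k₁ k₂ k₃))
      (Deg<-- (suc (suc i)) (Deg<-*ʳ (suc (suc i)) (sumℤ k₂ k₃ Y) (Deg<-sumℤ-lower (suc i) k₂ (Deg<-pow i)))
                            (Deg<-mono {1} {suc (suc i)} (s≤s z≤n) (Deg<-const (X k₂ * Y k₂))))
    where
    X = λ x → pow (ι x) i
    Y = λ y → pow (ι y) j

  Deg<₂-doubleSum-monomial : ∀ i j k₁ k₃ → Deg< (3 ℕ.+ (i ℕ.+ j)) (λ k₂ → doubleSum (monomial i j) k₁ k₂ k₃)
  Deg<₂-doubleSum-monomial i j k₁ k₃ =
    Deg<-cong (3 ℕ.+ (i ℕ.+ j)) (λ k₂ → sym (doubleSum-separable X Y k₁ k₂ k₃))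
      (Deg<-- (3 ℕ.+ (i ℕ.+ j))
        (≡.subst (λ n → Deg< (suc (suc n)) (λ t → sumℤ k₁ t X * sumℤ t k₃ Y)) (ℕP.+-suc i j)
          (Deg<-* (suc i) (suc j) (Deg<-sumℤ-upper (suc i) k₁ (Deg<-pow i)) (Deg<-sumℤ-lower (suc j) k₃ (Deg<-pow j))))
        (Deg<-mono {suc (i ℕ.+ j)} {3 ℕ.+ (i ℕ.+ j)} {λ t → X t * Y t} (ℕP.m≤n+m _ 2)
          (Deg<-* i j (Deg<-pow i) (Deg<-pow j))))
    where
    X = λ x → pow (ι x) i
    Y = λ y → pow (ι y) j

  Deg<₃-doubleSum-monomial : ∀ i j k₁ k₂ → Deg< (suc (suc j)) (λ k₃ → doubleSum (monomial i j) k₁ k₂ k₃)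
  Deg<₃-doubleSum-monomial i j k₁ k₂ =
    Deg<-cong (suc (suc j)) (λ k₃ → sym (doubleSum-separable X Y k₁ k₂ k₃))
      (Deg<-- (suc (suc j)) (Deg<-*ˡ (suc (suc j)) (sumℤ k₁ k₂ X) (Deg<-sumℤ-upper (suc j) k₂ (Deg<-pow j)))
                            (Deg<-mono {1} {suc (suc j)} (s≤s z≤n) (Deg<-const (X k₂ * Y k₂))))
    where
    X = λ x → pow (ι x) i
    Y = λ y → pow (ι y) j

  Deg<₁-doubleSum-monomials : ∀ d M L b → (∀ i → i ℕ.< M → i ℕ.≤ d) →
                              ∀ k₂ k₃ → Deg< (2 ℕ.+ d) (λ k₁ → doubleSum (monomials M L b) k₁ k₂ k₃)
  Deg<₁-doubleSum-monomials d M L b bound k₂ k₃ =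
    Deg<-cong (2 ℕ.+ d) (λ k₁ → sym (doubleSum-monomials M L b k₁ k₂ k₃))
      (Deg<-sumℕ² (2 ℕ.+ d) M L _ (λ i j i<M _ →
        Deg<-*ˡ (2 ℕ.+ d) (b i j) (Deg<-mono (s≤s (s≤s (bound i i<M))) (Deg<₁-doubleSum-monomial i j k₂ k₃))))

  Deg<₂-doubleSum-monomials : ∀ d M L b → (∀ i j → i ℕ.< M → j ℕ.< L i → i ℕ.+ j ℕ.≤ d) →
                              ∀ k₁ k₃ → Deg< (3 ℕ.+ d) (λ k₂ → doubleSum (monomials M L b) k₁ k₂ k₃)
  Deg<₂-doubleSum-monomials d M L b bound k₁ k₃ =
    Deg<-cong (3 ℕ.+ d) (λ k₂ → sym (doubleSum-monomials M L b k₁ k₂ k₃))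
      (Deg<-sumℕ² (3 ℕ.+ d) M L _ (λ i j i<M j<L →
        Deg<-*ˡ (3 ℕ.+ d) (b i j) (Deg<-mono (s≤s (s≤s (s≤s (bound i j i<M j<L)))) (Deg<₂-doubleSum-monomial i j k₁ k₃))))

  Deg<₃-doubleSum-monomials : ∀ d M L b → (∀ i j → i ℕ.< M → j ℕ.< L i → j ℕ.≤ d) →
                              ∀ k₁ k₂ → Deg< (2 ℕ.+ d) (λ k₃ → doubleSum (monomials M L b) k₁ k₂ k₃)
  Deg<₃-doubleSum-monomials d M L b bound k₁ k₂ =
    Deg<-cong (2 ℕ.+ d) (λ k₃ → sym (doubleSum-monomials M L b k₁ k₂ k₃))
      (Deg<-sumℕ² (2 ℕ.+ d) M L _ (λ i j i<M j<L →
        Deg<-*ˡ (2 ℕ.+ d) (b i j) (Deg<-mono (s≤s (s≤s (bound i j i<M j<L))) (Deg<₃-doubleSum-monomial i j k₁ k₂))))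

module PolynomialDoubleSum {c ℓ} (R : CommutativeRing c ℓ) (q : Poly.QAlgebra R)
                           (r : ℕ) (a : ℕ → ℕ → CommutativeRing.Carrier R) where
  open CommutativeRing R
  open Poly R
  open Degree R
  open TwoVariables R
  open DoubleSums R

  A W : Fn2
  A = polyA r a
  W = Winv q (suc r) A

  A≈T+staircase : ∀ x y → A x y ≈ T q (suc r) A x y + staircase (skew W) x y
  A≈T+staircase x y =
    trans (sym (Winv-inverse q (suc r) A (iter-D-vanishes (suc r) (Deg<ˣʸ-polyA r a)) x y))
          (V-decomposition W x y)

  Deg<₁-doubleSum-A : ∀ k₂ k₃ → Deg< (2 ℕ.+ r) (λ k₁ → doubleSum A k₁ k₂ k₃)
  Deg<₁-doubleSum-A = Deg<₁-doubleSum-monomials r (suc r) (λ _ → suc r) a (λ { i (s≤s i≤r) → i≤r })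

  Deg<₃-doubleSum-A : ∀ k₁ k₂ → Deg< (2 ℕ.+ r) (doubleSum A k₁ k₂)
  Deg<₃-doubleSum-A = Deg<₃-doubleSum-monomials r (suc r) (λ _ → suc r) a (λ { i j _ (s≤s j≤r) → j≤r })

  Deg<₂-doubleSum-staircase : ∀ k₁ k₃ → Deg< (2 ℕ.+ r) (λ k₂ → doubleSum (staircase (skew W)) k₁ k₂ k₃)
  Deg<₂-doubleSum-staircase = Deg<-doubleSum-staircase (suc r) (λ x y → W (x ℤ.+ 1ℤ) y)
    (Deg<ˣʸ-skew (suc r) (Deg<ˣʸ-Winv q (suc r) (suc r) (Deg<ˣʸ-polyA r a)))

  Deg<₂-doubleSum-T : TotDeg≤ r (T q (suc r) A) →
                      ∀ k₁ k₃ → Deg< (3 ℕ.+ r) (λ k₂ → doubleSum (T q (suc r) A) k₁ k₂ k₃)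
  Deg<₂-doubleSum-T (b , T≈monomials) k₁ k₃ =
    Deg<-cong (3 ℕ.+ r) (λ k₂ → sym (doubleSum-cong T≈monomials k₁ k₂ k₃))
      (Deg<₂-doubleSum-monomials r (suc r) (λ i → suc (r ℕ.∸ i)) b bound k₁ k₃)
    where
    bound : ∀ i j → i ℕ.< suc r → j ℕ.< suc (r ℕ.∸ i) → i ℕ.+ j ℕ.≤ r
    bound i j (s≤s i≤r) (s≤s j≤r∸i) = ≡.subst (i ℕ.+ j ℕ.≤_) (ℕP.m+[n∸m]≡n i≤r) (ℕP.+-monoʳ-≤ i j≤r∸i)

lemma2 : ∀ {c ℓ} (R : CommutativeRing c ℓ) (q : Poly.QAlgebra R)
         (r : ℕ) (a : ℕ → ℕ → CommutativeRing.Carrier R) →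
         (Poly.TotDeg≤ R r (Poly.T R q (suc r) (Poly.polyA R r a)) →
            Poly.DegK₂≤ R (r ℕ.+ 2) (Poly.doubleSum R (Poly.polyA R r a)))
         × ((∀ x y → CommutativeRing._≈_ R (Poly.T R q (suc r) (Poly.polyA R r a) x y) (CommutativeRing.0# R)) →
            Poly.DegK₂≤ R (r ℕ.+ 1) (Poly.doubleSum R (Poly.polyA R r a)))
lemma2 R q r a = part₁ , part₂
  where
  open CommutativeRing R
  open Poly R
  open Degree R
  open TwoVariables R
  open DoubleSums R
  open Interpolation R q
  open PolynomialDoubleSum R q r a

  interpolate : ∀ d → (∀ k₁ k₃ → Deg< (suc d) (λ k₂ → doubleSum A k₁ k₂ k₃)) → DegK₂≤ d (doubleSum A)
  interpolate d dy = Deg<³⇒DegK₂≤ (2 ℕ.+ r) d (doubleSum A) Deg<₁-doubleSum-A dy Deg<₃-doubleSum-A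

  part₁ : TotDeg≤ r (T q (suc r) A) → DegK₂≤ (r ℕ.+ 2) (doubleSum A)
  part₁ T-small = interpolate (r ℕ.+ 2) λ k₁ k₃ →
    ≡.subst (λ n → Deg< n (λ k₂ → doubleSum A k₁ k₂ k₃)) (≡.cong suc (ℕP.+-comm 2 r))
      (Deg<-cong (3 ℕ.+ r)
        (λ k₂ → sym (trans (doubleSum-cong A≈T+staircase k₁ k₂ k₃) (doubleSum-+ _ _ k₁ k₂ k₃)))
        (Deg<-+ (3 ℕ.+ r) (Deg<₂-doubleSum-T T-small k₁ k₃)
                          (Deg<-mono {2 ℕ.+ r} (ℕP.n≤1+n _) (Deg<₂-doubleSum-staircase k₁ k₃))))

  part₂ : (∀ x y → T q (suc r) A x y ≈ 0#) → DegK₂≤ (r ℕ.+ 1) (doubleSum A)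
  part₂ T≈0 = interpolate (r ℕ.+ 1) λ k₁ k₃ →
    ≡.subst (λ n → Deg< n (λ k₂ → doubleSum A k₁ k₂ k₃)) (≡.cong suc (ℕP.+-comm 1 r))
      (Deg<-cong (2 ℕ.+ r) (λ k₂ → sym (doubleSum-cong A≈staircase k₁ k₂ k₃)) (Deg<₂-doubleSum-staircase k₁ k₃))
    where
    A≈staircase : ∀ x y → A x y ≈ staircase (skew W) x y
    A≈staircase x y = trans (A≈T+staircase x y) (trans (+-congʳ (T≈0 x y)) (+-identityˡ _))
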